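{- Let $n$ be an odd positive integer and $k\geq 3$ an odd integer. Suppose that either (i) $k\equiv 0\pmod n$, or (ii) $n=p^\alpha$ for some prime $p$ and positive integer $\alpha$, and $p-1\nmid (k-1)$. Then \[ \frac{1}{k+1}\sum_{\ell=0}^{k}\binom{k+1}{\ell}B^{+}_\ell\, n^{k-\ell-1}\in\mathbb{N} \qquad\text{and}\qquad \frac{1}{k+1}\sum_{\ell=0}^{k}(-1)^\ell B_\ell\binom{k+1}{\ell}\, n^{k-\ell-1}\in\mathbb{N}, \] where $B_\ell$ are the Bernoulli numbers with $B_1=-1/2$, and $B^{+}_\ell$ are the Bernoulli numbers with the convention $B^{+}_1=1/2$ (and $B^{+}_\ell=B_\ell$ for $\ell\neq 1$).
   Context: The Bernoulli numbers $B_\ell$ are defined by $\frac{t}{e^t-1}=\sum_{\ell\ge 0}B_\ell\frac{t^\ell}{\ell!}$, so $B_0=1$, $B_1=-1/2$, $B_2=1/6$, and $B_\ell=0$ for odd $\ell\geq 3$. $\mathbb{N}$ denotes the positive integers. -}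

module Defs where

open import Data.Nat as ℕ using (ℕ; zero; suc; NonZero)
open import Data.Nat.Combinatorics using (_C_)
open import Data.Integer using (+_)
open import Data.List using (List; []; _∷_; _++_; upTo; map; foldr)
open import Data.Rational using (ℚ; _/_; _+_; _*_; -_; 0ℚ; 1ℚ; ½)

ℕtoℚ : ℕ → ℚ
ℕtoℚ n = (+ n) / 1

invℕ : (n : ℕ) → .{{_ : NonZero n}} → ℚ
invℕ n = (+ 1) / n

sumQ : ℕ → (ℕ → ℚ) → ℚ
sumQ zero    f = 0ℚ
sumQ (suc m) f = sumQ m f + f m

signQ : ℕ → ℚ
signQ zero    = 1ℚ
signQ (suc ℓ) = - signQ ℓ

at : List ℚ → ℕ → ℚ
at []       _       = 0ℚ
at (x ∷ xs) zero    = x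
at (x ∷ xs) (suc i) = at xs i

lastQ : List ℚ → ℚ
lastQ []           = 0ℚ
lastQ (x ∷ [])     = x
lastQ (x ∷ y ∷ xs) = lastQ (y ∷ xs)

-- the list [B_0, ..., B_m] of Bernoulli numbers (t/(e^t-1) convention, B_1 = -1/2),
-- computed by the standard recurrence equivalent to the generating function:
--   B_0 = 1,   B_m = - 1/(m+1) * Σ_{j=0}^{m-1} C(m+1, j) B_j   (m ≥ 1)
bernList : ℕ → List ℚ
bernList zero    = 1ℚ ∷ []
bernList (suc m) =
  bs ++ ((- (invℕ (suc (suc m)) * sumQ (suc m) (λ j → ℕtoℚ (suc (suc m) C j) * at bs j))) ∷ [])
  where bs = bernList m

B : ℕ → ℚ
B ℓ = lastQ (bernList ℓ)

B⁺ : ℕ → ℚ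
B⁺ (suc zero) = ½
B⁺ ℓ          = B ℓ

-- n^{k-ℓ-1} for 0 ≤ ℓ ≤ k, written as n^(k-ℓ) * (1/n)
powShift : (n : ℕ) → .{{_ : NonZero n}} → ℕ → ℕ → ℚ
powShift n k ℓ = ℕtoℚ (n ℕ.^ (k ℕ.∸ ℓ)) * invℕ n

S⁺ : (n : ℕ) → .{{_ : NonZero n}} → ℕ → ℚ
S⁺ n k = invℕ (suc k) * sumQ (suc k) (λ ℓ → ℕtoℚ (suc k C ℓ) * B⁺ ℓ * powShift n k ℓ)

S⁻ : (n : ℕ) → .{{_ : NonZero n}} → ℕ → ℚ
S⁻ n k = invℕ (suc k) * sumQ (suc k) (λ ℓ → signQ ℓ * B ℓ * ℕtoℚ (suc k C ℓ) * powShift n k ℓ)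

Inℕ : ℚ → Set
Inℕ q = Data.Product.Σ ℕ (λ m → (1 ℕ.≤ m) Data.Product.× (q ≡ ℕtoℚ m))
  where open import Data.Product
        open import Relation.Binary.PropositionalEquality

-- Both sums equal T / n², where T = 1^k + 2^k + ⋯ + n^k. For S⁺ this is Faulhaber's formula
-- T = (B_{k+1}(n+1) − B_{k+1}) / (k+1) read termwise; for S⁻ the Bernoulli polynomial at −n
-- yields the same T because k is odd. It therefore suffices to show n² ∣ T.
--
-- Pairing j with n − j gives 2T ≡ k·n·U (mod n²), where U = Σ_{j≤n} j^(k−1), so as n is odd it
-- suffices that n ∣ kU. This is clear when n ∣ k. When n = p^α with p − 1 ∤ k − 1, Fermat's little
-- theorem reduces the exponent modulo p − 1 and the recurrence Σ_{i≤r} C(r+1,i) Σ_{j<N} j^i = N^(r+1)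
-- then gives p ∣ Σ_{j<p} j^m for m = k − 1. Writing j < pq as j = tq + i lifts q ∣ Σ_{j<q} j^m to
-- pq ∣ 2 Σ_{j<pq} j^m whenever p ∣ q, and hence p ∣ Σ_{j<p} j^m to p^α ∣ Σ_{j<p^α} j^m.

module Submission where

open import Algebra.Bundles using (CommutativeSemiring)
open import Data.Nat.Base using (ℕ; suc)
open import Data.Nat.Primality using (Prime)

module NaturalPowerSums where

  open import Data.Nat using (ℕ; zero; suc; _+_; _^_)

  powerSumℕ : ℕ → ℕ → ℕ
  powerSumℕ zero    m = 0
  powerSumℕ (suc N) m = powerSumℕ N m + N ^ m

module RangeSums {a ℓ} (R : CommutativeSemiring a ℓ) where

  open CommutativeSemiring R
  open import Algebra.Properties.Semiring.Mult semiring using (_×_; ×-homo-+; ×1-homo-*)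
  open import Algebra.Properties.Semiring.Exp semiring public using (_^_; ^-homo-*)
  open import Algebra.Solver.Ring.NaturalCoefficients.Default R
  open import Data.Nat as ℕ using (ℕ; zero; suc; _∸_; _<_; _≤_; z≤n; s≤s)
  import Data.Nat.Properties as ℕ
  open import Data.Nat.Combinatorics using (_C_; nCk+nC[k+1]≡[n+1]C[k+1]; k>n⇒nCk≡0)
  open import Data.Sum using (inj₁; inj₂)
  open NaturalPowerSums using (powerSumℕ)
  open import Relation.Binary.PropositionalEquality as ≡ using (_≡_; _≢_)
  open import Relation.Binary.Reasoning.Setoid setoid

  sum : ℕ → (ℕ → Carrier) → Carrier
  sum zero    f = 0#
  sum (suc m) f = sum m f + f m

  fromℕ : ℕ → Carrier
  fromℕ n = n × 1#

  fromℕ-+ : ∀ a b → fromℕ (a ℕ.+ b) ≈ fromℕ a + fromℕ b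
  fromℕ-+ a b = ×-homo-+ 1# a b

  fromℕ-* : ∀ a b → fromℕ (a ℕ.* b) ≈ fromℕ a * fromℕ b
  fromℕ-* = ×1-homo-*

  sum-cong-< : ∀ m {f g} → (∀ i → i < m → f i ≈ g i) → sum m f ≈ sum m g
  sum-cong-< zero    f≈g = refl
  sum-cong-< (suc m) f≈g =
    +-cong (sum-cong-< m (λ i i<m → f≈g i (ℕ.m<n⇒m<1+n i<m))) (f≈g m ℕ.≤-refl)

  sum-cong : ∀ m {f g} → (∀ i → f i ≈ g i) → sum m f ≈ sum m g
  sum-cong m f≈g = sum-cong-< m (λ i _ → f≈g i)

  sum-+ : ∀ m f g → sum m (λ i → f i + g i) ≈ sum m f + sum m g
  sum-+ zero    f g = sym (+-identityˡ 0#)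
  sum-+ (suc m) f g = begin
    sum m (λ i → f i + g i) + (f m + g m) ≈⟨ +-congʳ (sum-+ m f g) ⟩
    (sum m f + sum m g) + (f m + g m)     ≈⟨ solve 4 (λ a b c d → (a :+ b) :+ (c :+ d) := (a :+ c) :+ (b :+ d))
                                                     refl (sum m f) (sum m g) (f m) (g m) ⟩
    (sum m f + f m) + (sum m g + g m)     ∎

  *-distribˡ-sum : ∀ m x f → x * sum m f ≈ sum m (λ i → x * f i)
  *-distribˡ-sum zero    x f = zeroʳ x
  *-distribˡ-sum (suc m) x f = trans (distribˡ x (sum m f) (f m)) (+-congʳ (*-distribˡ-sum m x f))

  *-distribʳ-sum : ∀ m x f → sum m f * x ≈ sum m (λ i → f i * x)
  *-distribʳ-sum m x f = begin
    sum m f * x              ≈⟨ *-comm _ x ⟩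
    x * sum m f              ≈⟨ *-distribˡ-sum m x f ⟩
    sum m (λ i → x * f i)    ≈⟨ sum-cong m (λ i → *-comm x (f i)) ⟩
    sum m (λ i → f i * x)    ∎

  sum-zero : ∀ m f → (∀ i → i < m → f i ≈ 0#) → sum m f ≈ 0#
  sum-zero zero    f f≈0 = refl
  sum-zero (suc m) f f≈0 = begin
    sum m f + f m ≈⟨ +-cong (sum-zero m f (λ i i<m → f≈0 i (ℕ.m<n⇒m<1+n i<m))) (f≈0 m ℕ.≤-refl) ⟩
    0# + 0#       ≈⟨ +-identityˡ 0# ⟩
    0#            ∎

  sum-comm : ∀ a b (f : ℕ → ℕ → Carrier) →
             sum a (λ i → sum b (f i)) ≈ sum b (λ j → sum a (λ i → f i j))
  sum-comm zero    b f = sym (sum-zero b _ (λ _ _ → refl))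
  sum-comm (suc a) b f = begin
    sum a (λ i → sum b (f i)) + sum b (f a)         ≈⟨ +-congʳ (sum-comm a b f) ⟩
    sum b (λ j → sum a (λ i → f i j)) + sum b (f a) ≈⟨ sym (sum-+ b _ _) ⟩
    sum b (λ j → sum (suc a) (λ i → f i j))         ∎

  sum-head : ∀ m f → sum (suc m) f ≈ f 0 + sum m (λ i → f (suc i))
  sum-head zero    f = trans (+-identityˡ _) (sym (+-identityʳ _))
  sum-head (suc m) f = begin
    sum (suc m) f + f (suc m)                    ≈⟨ +-congʳ (sum-head m f) ⟩
    (f 0 + sum m (λ i → f (suc i))) + f (suc m)  ≈⟨ +-assoc _ _ _ ⟩
    f 0 + sum (suc m) (λ i → f (suc i))          ∎

  sum-split : ∀ a b f → sum (a ℕ.+ b) f ≈ sum a f + sum b (λ i → f (a ℕ.+ i))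
  sum-split a zero    f = begin
    sum (a ℕ.+ 0) f ≡⟨ ≡.cong (λ m → sum m f) (ℕ.+-identityʳ a) ⟩
    sum a f         ≈⟨ sym (+-identityʳ _) ⟩
    sum a f + 0#    ∎
  sum-split a (suc b) f = begin
    sum (a ℕ.+ suc b) f                                  ≡⟨ ≡.cong (λ m → sum m f) (ℕ.+-suc a b) ⟩
    sum (a ℕ.+ b) f + f (a ℕ.+ b)                        ≈⟨ +-congʳ (sum-split a b f) ⟩
    (sum a f + sum b (λ i → f (a ℕ.+ i))) + f (a ℕ.+ b) ≈⟨ +-assoc _ _ _ ⟩
    sum a f + sum (suc b) (λ i → f (a ℕ.+ i))            ∎

  sum-blocks : ∀ p q f → sum (p ℕ.* q) f ≈ sum p (λ t → sum q (λ i → f (t ℕ.* q ℕ.+ i)))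
  sum-blocks zero    q f = refl
  sum-blocks (suc p) q f = begin
    sum (q ℕ.+ p ℕ.* q) f                                ≡⟨ ≡.cong (λ m → sum m f) (ℕ.+-comm q (p ℕ.* q)) ⟩
    sum (p ℕ.* q ℕ.+ q) f                                ≈⟨ sum-split (p ℕ.* q) q f ⟩
    sum (p ℕ.* q) f + sum q (λ i → f (p ℕ.* q ℕ.+ i))   ≈⟨ +-congʳ (sum-blocks p q f) ⟩
    sum (suc p) (λ t → sum q (λ i → f (t ℕ.* q ℕ.+ i))) ∎

  sum-reverse : ∀ m f → sum m f ≈ sum m (λ i → f (m ∸ suc i))
  sum-reverse zero    f = refl
  sum-reverse (suc m) f = begin
    sum m f + f m                          ≈⟨ +-comm _ _ ⟩
    f m + sum m f                          ≈⟨ +-congˡ (sum-reverse m f) ⟩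
    f m + sum m (λ i → f (m ∸ suc i))      ≈⟨ sym (sum-head m _) ⟩
    sum (suc m) (λ i → f (suc m ∸ suc i))  ∎

  sum-truncate : ∀ M N f → M ≤ N → (∀ i → M ≤ i → i < N → f i ≈ 0#) → sum N f ≈ sum M f
  sum-truncate M zero    f z≤n  _    = refl
  sum-truncate M (suc N) f M≤1+N tail≈0 with ℕ.m≤n⇒m<n∨m≡n M≤1+N
  ... | inj₂ ≡.refl = refl
  ... | inj₁ (s≤s M≤N) = begin
    sum N f + f N ≈⟨ +-cong (sum-truncate M N f M≤N (λ i M≤i i<N → tail≈0 i M≤i (ℕ.m<n⇒m<1+n i<N)))
                            (tail≈0 N M≤N ℕ.≤-refl) ⟩
    sum M f + 0#  ≈⟨ +-identityʳ _ ⟩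
    sum M f       ∎

  sum-delta : ∀ m j f → j < m → (∀ i → i < m → i ≢ j → f i ≈ 0#) → sum m f ≈ f j
  sum-delta (suc m) j f j<1+m others≈0 with ℕ.m≤n⇒m<n∨m≡n j<1+m
  ... | inj₂ ≡.refl = begin
    sum m f + f m ≈⟨ +-congʳ (sum-zero m f (λ i i<m → others≈0 i (ℕ.m<n⇒m<1+n i<m) (ℕ.<⇒≢ i<m))) ⟩
    0# + f m      ≈⟨ +-identityˡ _ ⟩
    f m           ∎
  ... | inj₁ (s≤s j<m) = begin
    sum m f + f m ≈⟨ +-cong (sum-delta m j f j<m (λ i i<m → others≈0 i (ℕ.m<n⇒m<1+n i<m)))
                            (others≈0 m ℕ.≤-refl (ℕ.>⇒≢ j<m)) ⟩
    f j + 0#      ≈⟨ +-identityʳ _ ⟩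
    f j           ∎

  binomial : ∀ r x → (x + 1#) ^ r ≈ sum (suc r) (λ i → fromℕ (r C i) * x ^ i)
  binomial zero    x = sym (trans (+-identityˡ _) (trans (*-identityʳ _) (+-identityʳ _)))
  binomial (suc r) x = begin
    (x + 1#) * (x + 1#) ^ r                     ≈⟨ *-congˡ (binomial r x) ⟩
    (x + 1#) * S                                ≈⟨ distribʳ S x 1# ⟩
    x * S + 1# * S                              ≈⟨ +-cong x*S (*-identityˡ S) ⟩
    A + S                                       ≈⟨ +-congˡ (sum-head r term) ⟩
    A + (one + B)                               ≈⟨ solve 3 (λ a b u → a :+ (u :+ b) := u :+ (a :+ (b :+ con 0)))
                                                           refl A B one ⟩
    one + (A + (B + 0#))                        ≈⟨ +-congˡ (+-congˡ (+-congˡ top≈0)) ⟩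
    one + (A + sum (suc r) (λ i → c r (suc i) * x ^ suc i))
                                                ≈⟨ +-congˡ (sym (sum-+ (suc r) _ _)) ⟩
    one + sum (suc r) (λ i → c r i * x ^ suc i + c r (suc i) * x ^ suc i)
                                                ≈⟨ +-congˡ (sum-cong (suc r) pascal) ⟩
    c (suc r) 0 * x ^ 0 + sum (suc r) (λ i → c (suc r) (suc i) * x ^ suc i)
                                                ≈⟨ sym (sum-head (suc r) _) ⟩
    sum (suc (suc r)) (λ i → c (suc r) i * x ^ i) ∎
    where
    c : ℕ → ℕ → Carrier
    c r i = fromℕ (r C i)
    term : ℕ → Carrier
    term i = c r i * x ^ i
    S = sum (suc r) term
    A = sum (suc r) (λ i → c r i * x ^ suc i)
    B = sum r (λ i → c r (suc i) * x ^ suc i)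
    one = fromℕ 1 * 1#
    x*S : x * S ≈ A
    x*S = trans (*-distribˡ-sum (suc r) x term)
                (sum-cong (suc r) (λ i → solve 3 (λ x c p → x :* (c :* p) := c :* (x :* p))
                                                 refl x (c r i) (x ^ i)))
    top≈0 : 0# ≈ c r (suc r) * x ^ suc r
    top≈0 = trans (sym (zeroˡ (x ^ suc r)))
                  (*-congʳ (reflexive (≡.cong fromℕ (≡.sym (k>n⇒nCk≡0 (ℕ.n<1+n r))))))
    pascal : ∀ i → c r i * x ^ suc i + c r (suc i) * x ^ suc i ≈ c (suc r) (suc i) * x ^ suc i
    pascal i = trans (sym (distribʳ _ _ _))
                     (*-congʳ (trans (sym (fromℕ-+ (r C i) (r C suc i)))
                                     (reflexive (≡.cong fromℕ (nCk+nC[k+1]≡[n+1]C[k+1] r i)))))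

  binomial-padded : ∀ r N x → r < N → (x + 1#) ^ r ≈ sum N (λ i → fromℕ (r C i) * x ^ i)
  binomial-padded r N x r<N = trans (binomial r x) (sym (sum-truncate (suc r) N _ r<N vanish))
    where
    vanish : ∀ i → suc r ≤ i → i < N → fromℕ (r C i) * x ^ i ≈ 0#
    vanish i r<i _ = trans (*-congʳ (reflexive (≡.cong fromℕ (k>n⇒nCk≡0 r<i)))) (zeroˡ _)

  fromℕ-^ : ∀ a b → fromℕ (a ℕ.^ b) ≈ fromℕ a ^ b
  fromℕ-^ a zero    = +-identityʳ 1#
  fromℕ-^ a (suc b) = trans (fromℕ-* a (a ℕ.^ b)) (*-congˡ (fromℕ-^ a b))

  fromℕ-powerSumℕ : ∀ N m → fromℕ (powerSumℕ N m) ≈ sum N (λ j → fromℕ j ^ m)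
  fromℕ-powerSumℕ zero    m = refl
  fromℕ-powerSumℕ (suc N) m =
    trans (fromℕ-+ (powerSumℕ N m) (N ℕ.^ m)) (+-cong (fromℕ-powerSumℕ N m) (fromℕ-^ N m))

module BinomialsAndPrimes where

  open import Data.Nat
  open import Data.Nat.Properties
  open import Data.Nat.Divisibility using (_∣_; _∤_; ∣⇒≤; ∣1⇒≡1; m∣m*n)
  open import Data.Nat.Primality using (Prime; prime; euclidsLemma; prime⇒irreducible)
  open import Data.Nat.Coprimality using (Coprime)
  open import Data.Product using (_,_)
  open import Data.Nat.Combinatorics
    using (_C_; nCk≡n!/k![n-k]!; k![n∸k]!∣n!; k>n⇒nCk≡0; nCk≡nC[n∸k]; nC1≡n)
  open import Data.Nat.DivMod using (m/n*n≡m)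
  open import Data.Nat.Tactic.RingSolver using (solve-∀)
  open import Data.Sum using (inj₁; inj₂)
  open import Relation.Binary.PropositionalEquality
  open import Relation.Nullary using (yes; no; contradiction)
  open import Function using (_∘_)

  nCk*k!*[n∸k]!≡n! : ∀ {n k} → k ≤ n → (n C k) * (k ! * (n ∸ k) !) ≡ n !
  nCk*k!*[n∸k]!≡n! {n} {k} k≤n =
    trans (cong (_* (k ! * (n ∸ k) !)) (nCk≡n!/k![n-k]! k≤n))
          (m/n*n≡m {{k !* (n ∸ k) !≢0}} (k![n∸k]!∣n! k≤n))

  ≤∸-swap : ∀ {n k j} → k ≤ n → j ≤ n ∸ k → k ≤ n ∸ j
  ≤∸-swap {n} {k} {j} k≤n j≤n∸k =
    m+n≤o⇒m≤o∸n k (subst (_≤ n) (+-comm j k) (m≤o∸n⇒m+n≤o j k≤n j≤n∸k))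

  -- Both sides count the ways of choosing disjoint subsets of sizes k and j from an n-set.
  nCk*[n∸k]Cj≡nCj*[n∸j]Ck : ∀ n k j → k ≤ n → j ≤ n →
                            (n C k) * ((n ∸ k) C j) ≡ (n C j) * ((n ∸ j) C k)
  nCk*[n∸k]Cj≡nCj*[n∸j]Ck n k j k≤n j≤n with j ≤? n ∸ k
  ... | no j≰n∸k = begin
    (n C k) * ((n ∸ k) C j) ≡⟨ cong ((n C k) *_) (k>n⇒nCk≡0 (≰⇒> j≰n∸k)) ⟩
    (n C k) * 0             ≡⟨ *-zeroʳ (n C k) ⟩
    0                       ≡⟨ *-zeroʳ (n C j) ⟨
    (n C j) * 0             ≡⟨ cong ((n C j) *_) (k>n⇒nCk≡0 (≰⇒> k≰n∸j)) ⟨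
    (n C j) * ((n ∸ j) C k) ∎
    where
    open ≡-Reasoning
    k≰n∸j : k ≰ n ∸ j
    k≰n∸j = j≰n∸k ∘ ≤∸-swap j≤n
  ... | yes j≤n∸k = *-cancelʳ-≡ _ _ (k ! * (j ! * r !)) {{k!j!r!≢0}} (trans side-k (sym side-j))
    where
    r = n ∸ k ∸ j
    k!j!r!≢0 = m*n≢0 (k !) (j ! * r !) {{k !≢0}} {{m*n≢0 (j !) (r !) {{j !≢0}} {{r !≢0}}}}
    k≤n∸j : k ≤ n ∸ j
    k≤n∸j = ≤∸-swap k≤n j≤n∸k
    n∸j∸k≡r : n ∸ j ∸ k ≡ r
    n∸j∸k≡r = trans (∸-+-assoc n j k) (trans (cong (n ∸_) (+-comm j k)) (sym (∸-+-assoc n k j)))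
    side-k : (n C k) * ((n ∸ k) C j) * (k ! * (j ! * r !)) ≡ n !
    side-k = trans (regroup (n C k) ((n ∸ k) C j) (k !) (j !) (r !))
                   (trans (cong (λ z → (n C k) * (k ! * z)) (nCk*k!*[n∸k]!≡n! j≤n∸k))
                          (nCk*k!*[n∸k]!≡n! k≤n))
      where regroup : ∀ a b x y z → a * b * (x * (y * z)) ≡ a * (x * (b * (y * z)))
            regroup = solve-∀
    side-j : (n C j) * ((n ∸ j) C k) * (k ! * (j ! * r !)) ≡ n !
    side-j = trans (regroup (n C j) ((n ∸ j) C k) (k !) (j !) (r !))
                   (trans (cong (λ z → (n C j) * (j ! * (((n ∸ j) C k) * (k ! * z !)))) (sym n∸j∸k≡r))
                   (trans (cong (λ z → (n C j) * (j ! * z)) (nCk*k!*[n∸k]!≡n! k≤n∸j))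
                          (nCk*k!*[n∸k]!≡n! j≤n)))
      where regroup : ∀ a b x y z → a * b * (x * (y * z)) ≡ a * (y * (b * (x * z)))
            regroup = solve-∀

  [1+n]Cn≡1+n : ∀ n → suc n C n ≡ suc n
  [1+n]Cn≡1+n n = trans (nCk≡nC[n∸k] (n≤1+n n)) (trans (cong (suc n C_) (1+n∸n≡1 n)) (nC1≡n (suc n)))
    where 1+n∸n≡1 : ∀ n → suc n ∸ n ≡ 1
          1+n∸n≡1 zero    = refl
          1+n∸n≡1 (suc n) = 1+n∸n≡1 n

  prime⇒1<p : ∀ {p} → Prime p → 1 < p
  prime⇒1<p (prime {{nt}} _) = nonTrivial⇒n>1 _ {{nt}}

  prime∤0<m<p : ∀ {p m} → Prime p → 0 < m → m < p → p ∤ m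
  prime∤0<m<p {m = suc m} _ _ m<p p∣m = <⇒≱ m<p (∣⇒≤ p∣m)

  prime∤m! : ∀ {p} m → Prime p → m < p → p ∤ m !
  prime∤m! zero    pr _   p∣1 = <⇒≢ (prime⇒1<p pr) (sym (∣1⇒≡1 p∣1))
  prime∤m! (suc m) pr m<p p∣m! with euclidsLemma (suc m) (m !) pr p∣m!
  ... | inj₁ p∣1+m = prime∤0<m<p pr z<s m<p p∣1+m
  ... | inj₂ p∣m!  = prime∤m! m pr (<-trans (n<1+n m) m<p) p∣m!

  prime∣pCk : ∀ {p k} → Prime p → 0 < k → k < p → p ∣ p C k
  prime∣pCk {suc p′} {k} pr 0<k k<p
    with euclidsLemma (suc p′ C k) (k ! * (suc p′ ∸ k) !) pr
           (subst (suc p′ ∣_) (sym (nCk*k!*[n∸k]!≡n! (<⇒≤ k<p))) (m∣m*n (p′ !)))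
  ... | inj₁ p∣pCk = p∣pCk
  ... | inj₂ p∣k!*[p∸k]! with euclidsLemma (k !) ((suc p′ ∸ k) !) pr p∣k!*[p∸k]!
  ...   | inj₁ p∣k!     = contradiction p∣k! (prime∤m! k pr k<p)
  ...   | inj₂ p∣[p∸k]! = contradiction p∣[p∸k]! (prime∤m! (suc p′ ∸ k) pr (∸-monoʳ-< 0<k (<⇒≤ k<p)))

  prime∤m⇒prime∤m^k : ∀ {p m} k → Prime p → p ∤ m → p ∤ m ^ k
  prime∤m⇒prime∤m^k zero    pr p∤m p∣1 = <⇒≢ (prime⇒1<p pr) (sym (∣1⇒≡1 p∣1))
  prime∤m⇒prime∤m^k {m = m} (suc k) pr p∤m p∣m^k+1 with euclidsLemma m (m ^ k) pr p∣m^k+1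
  ... | inj₁ p∣m   = p∤m p∣m
  ... | inj₂ p∣m^k = prime∤m⇒prime∤m^k k pr p∤m p∣m^k

  prime∤⇒coprime : ∀ {p n} → Prime p → p ∤ n → Coprime p n
  prime∤⇒coprime pr p∤n (i∣p , i∣n) with prime⇒irreducible pr i∣p
  ... | inj₁ i≡1 = i≡1
  ... | inj₂ refl = contradiction i∣n p∤n

module BernoulliNumbers where

  open import Defs
  open BinomialsAndPrimes using ([1+n]Cn≡1+n)
  open import Data.Nat as ℕ using (ℕ; zero; suc; _≤_; _<_; s≤s)
  import Data.Nat.Properties as ℕ
  open import Data.Nat.Combinatorics using (_C_; nCn≡1; k>n⇒nCk≡0)
  open import Data.Integer as ℤ using (+_)
  import Data.Integer.Properties as ℤ
  open import Data.Integer.Tactic.RingSolver using (solve-∀)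
  open import Data.List using (List; []; _∷_; _++_; length)
  open import Data.List.Properties using (length-++)
  open import Data.Rational using (ℚ; _+_; _*_; -_; 0ℚ; 1ℚ; toℚᵘ)
  open import Data.Rational.Properties
    using (toℚᵘ-injective; toℚᵘ-fromℚᵘ; toℚᵘ-homo-+; toℚᵘ-homo-*;
           +-*-commutativeRing; +-identityʳ; *-zeroˡ)
  import Data.Rational.Unnormalised as ℚᵘ
  import Data.Rational.Unnormalised.Properties as ℚᵘ
  open import Data.Rational.Solver using (module +-*-Solver)
  open +-*-Solver using (solve; _:+_; _:*_; :-_; _:=_; con)
  open import Algebra.Bundles using (CommutativeRing)
  open import Data.Sum using ([_,_]′)
  open import Data.Empty using (⊥-elim)
  open import Relation.Binary.PropositionalEquality

  open RangeSums (CommutativeRing.commutativeSemiring +-*-commutativeRing) public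

  private
    toℚᵘ-/ : ∀ i d → toℚᵘ (i Data.Rational./ suc d) ℚᵘ.≃ ℚᵘ.mkℚᵘ i d
    toℚᵘ-/ i d = toℚᵘ-fromℚᵘ (ℚᵘ.mkℚᵘ i d)

  ℕtoℚ≡fromℕ : ∀ a → ℕtoℚ a ≡ fromℕ a
  ℕtoℚ≡fromℕ zero    = refl
  ℕtoℚ≡fromℕ (suc a) = trans ℕtoℚ-suc (cong (λ q → 1ℚ + q) (ℕtoℚ≡fromℕ a))
    where
    cross : ((+ 1) ℤ.* (+ 1) ℤ.+ (+ a) ℤ.* (+ 1)) ℤ.* (+ 1) ≡ (+ suc a) ℤ.* (+ 1)
    cross = identity (+ a)
      where identity : ∀ x → ((+ 1) ℤ.* (+ 1) ℤ.+ x ℤ.* (+ 1)) ℤ.* (+ 1) ≡ ((+ 1) ℤ.+ x) ℤ.* (+ 1)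
            identity = solve-∀
    ℕtoℚ-suc : ℕtoℚ (suc a) ≡ 1ℚ + ℕtoℚ a
    ℕtoℚ-suc = toℚᵘ-injective
      (ℚᵘ.≃-trans (toℚᵘ-/ (+ suc a) 0)
        (ℚᵘ.≃-sym (ℚᵘ.≃-trans (toℚᵘ-homo-+ 1ℚ (ℕtoℚ a))
          (ℚᵘ.≃-trans (ℚᵘ.+-cong (toℚᵘ-/ (+ 1) 0) (toℚᵘ-/ (+ a) 0)) (ℚᵘ.*≡* cross)))))

  invℕ-inverseˡ : ∀ a → invℕ (suc a) * fromℕ (suc a) ≡ 1ℚ
  invℕ-inverseˡ a = trans (cong (invℕ (suc a) *_) (sym (ℕtoℚ≡fromℕ (suc a)))) (toℚᵘ-injective
    (ℚᵘ.≃-trans (toℚᵘ-homo-* (invℕ (suc a)) (ℕtoℚ (suc a)))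
      (ℚᵘ.≃-trans (ℚᵘ.*-cong (toℚᵘ-/ (+ 1) a) (toℚᵘ-/ (+ suc a) 0))
        (ℚᵘ.≃-trans (ℚᵘ.*≡* cross) (ℚᵘ.≃-sym (toℚᵘ-/ (+ 1) 0))))))
    where
    cross : ((+ 1) ℤ.* (+ suc a)) ℤ.* (+ 1) ≡ (+ 1) ℤ.* (+ (suc a ℕ.* 1))
    cross = trans (identity (+ suc a)) (cong ((+ 1) ℤ.*_) (sym (ℤ.pos-* (suc a) 1)))
      where identity : ∀ x → ((+ 1) ℤ.* x) ℤ.* (+ 1) ≡ (+ 1) ℤ.* (x ℤ.* (+ 1))
            identity = solve-∀

  sumQ≡sum : ∀ m f → sumQ m f ≡ sum m f
  sumQ≡sum zero    f = refl
  sumQ≡sum (suc m) f = cong (_+ f m) (sumQ≡sum m f)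

  private
    length-bernList : ∀ m → length (bernList m) ≡ suc m
    length-bernList zero    = refl
    length-bernList (suc m) =
      trans (length-++ (bernList m)) (trans (ℕ.+-comm (length (bernList m)) 1) (cong suc (length-bernList m)))

    at-++-init : ∀ xs y j → j < length xs → at (xs ++ y ∷ []) j ≡ at xs j
    at-++-init (x ∷ xs) y zero    _         = refl
    at-++-init (x ∷ xs) y (suc j) (s≤s j<n) = at-++-init xs y j j<n

    at-++-last : ∀ xs y j → j ≡ length xs → at (xs ++ y ∷ []) j ≡ y
    at-++-last []       y zero    _   = refl
    at-++-last (x ∷ xs) y (suc j) j≡n = at-++-last xs y j (ℕ.suc-injective j≡n)

    lastQ-++ : ∀ xs y → lastQ (xs ++ y ∷ []) ≡ y
    lastQ-++ []            y = refl
    lastQ-++ (x ∷ [])      y = refl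
    lastQ-++ (x ∷ x′ ∷ xs) y = lastQ-++ (x′ ∷ xs) y

    at-bernList : ∀ m j → j ≤ m → at (bernList m) j ≡ B j
    at-bernList zero    zero _     = refl
    at-bernList (suc m) j    j≤1+m = [ earlier , last ]′ (ℕ.m≤n⇒m<n∨m≡n j≤1+m)
      where
      earlier : j < suc m → at (bernList (suc m)) j ≡ B j
      earlier (s≤s j≤m) =
        trans (at-++-init (bernList m) _ j (subst (j <_) (sym (length-bernList m)) (s≤s j≤m))) (at-bernList m j j≤m)
      last : j ≡ suc m → at (bernList (suc m)) j ≡ B j
      last j≡1+m = trans (at-++-last (bernList m) _ j (trans j≡1+m (sym (length-bernList m))))
                         (sym (trans (cong B j≡1+m) (lastQ-++ (bernList m) _)))

  B-suc : ∀ m → B (suc m) ≡ - (invℕ (suc (suc m)) * sum (suc m) (λ j → fromℕ (suc (suc m) C j) * B j))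
  B-suc m = trans (lastQ-++ (bernList m) _) (cong (λ s → - (invℕ (suc (suc m)) * s))
    (trans (sumQ≡sum (suc m) _)
           (sum-cong-< (suc m) (λ j j≤m →
              cong₂ _*_ (ℕtoℚ≡fromℕ (suc (suc m) C j)) (at-bernList m j (ℕ.≤-pred j≤m))))))

  Σ-C-B≡0 : ∀ m → sum (suc (suc m)) (λ j → fromℕ (suc (suc m) C j) * B j) ≡ 0ℚ
  Σ-C-B≡0 m = begin
    S + fromℕ (suc (suc m) C suc m) * B (suc m) ≡⟨ cong (λ c → S + fromℕ c * B (suc m)) ([1+n]Cn≡1+n (suc m)) ⟩
    S + a * B (suc m)                           ≡⟨ cong (λ b → S + a * b) (B-suc m) ⟩
    S + a * (- (i * S))                         ≡⟨ solve 3 (λ S a i → S :+ a :* (:- (i :* S)) := S :+ (:- ((i :* a) :* S)))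
                                                           refl S a i ⟩
    S + (- ((i * a) * S))                       ≡⟨ cong (λ u → S + (- (u * S))) (invℕ-inverseˡ (suc m)) ⟩
    S + (- (1ℚ * S))                            ≡⟨ solve 1 (λ S → S :+ (:- (con 1ℚ :* S)) := con 0ℚ) refl S ⟩
    0ℚ                                          ∎
    where
    open ≡-Reasoning
    S = sum (suc m) (λ j → fromℕ (suc (suc m) C j) * B j)
    a = fromℕ (suc (suc m))
    i = invℕ (suc (suc m))

  -- Σ_{ℓ≤r} C(r,ℓ) B_ℓ = B_r holds for every r except r = 1, where the sum is 1/2 = B_1 + 1.
  δ₁ : ℕ → ℚ
  δ₁ 1 = 1ℚ
  δ₁ _ = 0ℚ

  δ₁≡0 : ∀ t → t ≢ 1 → δ₁ t ≡ 0ℚ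
  δ₁≡0 zero          _   = refl
  δ₁≡0 (suc zero)    t≢1 = ⊥-elim (t≢1 refl)
  δ₁≡0 (suc (suc t)) _   = refl

  B⁺≡B+δ₁ : ∀ ℓ → B⁺ ℓ ≡ B ℓ + δ₁ ℓ
  B⁺≡B+δ₁ zero          = refl
  B⁺≡B+δ₁ (suc zero)    = refl
  B⁺≡B+δ₁ (suc (suc ℓ)) = sym (+-identityʳ _)

  Σ-C-B≡B+δ₁ : ∀ r N → r < N → sum N (λ ℓ → fromℕ (r C ℓ) * B ℓ) ≡ B r + δ₁ r
  Σ-C-B≡B+δ₁ r N r<N = trans (sum-truncate (suc r) N _ r<N beyond-r) (full r)
    where
    beyond-r : ∀ i → r < i → i < N → fromℕ (r C i) * B i ≡ 0ℚ
    beyond-r i r<i _ = trans (cong (λ c → fromℕ c * B i) (k>n⇒nCk≡0 r<i)) (*-zeroˡ (B i))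
    full : ∀ r → sum (suc r) (λ ℓ → fromℕ (r C ℓ) * B ℓ) ≡ B r + δ₁ r
    full zero          = refl
    full (suc zero)    = refl
    full (suc (suc m)) = begin
      sum (suc (suc m)) f + fromℕ (suc (suc m) C suc (suc m)) * B (suc (suc m))
        ≡⟨ cong₂ (λ s c → s + fromℕ c * B (suc (suc m))) (Σ-C-B≡0 m) (nCn≡1 (suc (suc m))) ⟩
      0ℚ + fromℕ 1 * B (suc (suc m))
        ≡⟨ solve 1 (λ b → con 0ℚ :+ (con 1ℚ :+ con 0ℚ) :* b := b :+ con 0ℚ) refl (B (suc (suc m))) ⟩
      B (suc (suc m)) + 0ℚ ∎
      where open ≡-Reasoning
            f = λ ℓ → fromℕ (suc (suc m) C ℓ) * B ℓ

module BernoulliPolynomials where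

  open import Defs using (B)
  open BernoulliNumbers
  open BinomialsAndPrimes using (nCk*[n∸k]Cj≡nCj*[n∸j]Ck; [1+n]Cn≡1+n)
  open import Data.Nat as ℕ using (ℕ; suc; _∸_; _≤_; _<_; s≤s)
  import Data.Nat.Properties as ℕ
  open import Data.Nat.Combinatorics using (_C_; nCk≡nC[n∸k])
  open import Data.Rational using (ℚ; _+_; _*_; 0ℚ; 1ℚ)
  open import Data.Rational.Properties using (*-distribˡ-+; *-identityʳ; *-zeroʳ)
  open import Data.Rational.Solver using (module +-*-Solver)
  open +-*-Solver using (solve; _:*_; _:=_)
  open import Relation.Binary.PropositionalEquality

  bernoulliPoly : ℕ → ℚ → ℚ
  bernoulliPoly m x = sum (suc m) (λ ℓ → fromℕ (m C ℓ) * B ℓ * x ^ (m ∸ ℓ))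

  bernoulliPoly-+1 : ∀ m x → bernoulliPoly m (x + 1ℚ) ≡
                     sum (suc m) (λ i → fromℕ (m C i) * x ^ i * (B (m ∸ i) + δ₁ (m ∸ i)))
  bernoulliPoly-+1 m x = begin
    sum (suc m) (λ ℓ → c m ℓ * B ℓ * (x + 1ℚ) ^ (m ∸ ℓ))
      ≡⟨ sum-cong (suc m) expand ⟩
    sum (suc m) (λ ℓ → sum (suc m) (λ i → c m ℓ * B ℓ * (c (m ∸ ℓ) i * x ^ i)))
      ≡⟨ sum-cong-< (suc m) (λ ℓ ℓ≤m → sum-cong-< (suc m) (λ i i≤m →
           regroup ℓ i (ℕ.≤-pred ℓ≤m) (ℕ.≤-pred i≤m))) ⟩
    sum (suc m) (λ ℓ → sum (suc m) (λ i → c m i * x ^ i * (c (m ∸ i) ℓ * B ℓ)))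
      ≡⟨ sum-comm (suc m) (suc m) _ ⟩
    sum (suc m) (λ i → sum (suc m) (λ ℓ → c m i * x ^ i * (c (m ∸ i) ℓ * B ℓ)))
      ≡⟨ sum-cong (suc m) (λ i → sym (*-distribˡ-sum (suc m) (c m i * x ^ i) _)) ⟩
    sum (suc m) (λ i → c m i * x ^ i * sum (suc m) (λ ℓ → c (m ∸ i) ℓ * B ℓ))
      ≡⟨ sum-cong (suc m) (λ i → cong (c m i * x ^ i *_)
                                      (Σ-C-B≡B+δ₁ (m ∸ i) (suc m) (s≤s (ℕ.m∸n≤m m i)))) ⟩
    sum (suc m) (λ i → c m i * x ^ i * (B (m ∸ i) + δ₁ (m ∸ i))) ∎
    where
    open ≡-Reasoning
    c : ℕ → ℕ → ℚ
    c a b = fromℕ (a C b)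
    expand : ∀ ℓ → c m ℓ * B ℓ * (x + 1ℚ) ^ (m ∸ ℓ) ≡
                   sum (suc m) (λ i → c m ℓ * B ℓ * (c (m ∸ ℓ) i * x ^ i))
    expand ℓ = trans (cong (c m ℓ * B ℓ *_) (binomial-padded (m ∸ ℓ) (suc m) x (s≤s (ℕ.m∸n≤m m ℓ))))
                     (*-distribˡ-sum (suc m) (c m ℓ * B ℓ) _)
    regroup : ∀ ℓ i → ℓ ≤ m → i ≤ m →
              c m ℓ * B ℓ * (c (m ∸ ℓ) i * x ^ i) ≡ c m i * x ^ i * (c (m ∸ i) ℓ * B ℓ)
    regroup ℓ i ℓ≤m i≤m = begin
      c m ℓ * B ℓ * (c (m ∸ ℓ) i * x ^ i)
        ≡⟨ solve 4 (λ a b d p → a :* b :* (d :* p) := (a :* d) :* (b :* p))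
                   refl (c m ℓ) (B ℓ) (c (m ∸ ℓ) i) (x ^ i) ⟩
      (c m ℓ * c (m ∸ ℓ) i) * (B ℓ * x ^ i)
        ≡⟨ cong (_* (B ℓ * x ^ i)) (trans (sym (fromℕ-* (m C ℓ) ((m ∸ ℓ) C i)))
                                   (trans (cong fromℕ (nCk*[n∸k]Cj≡nCj*[n∸j]Ck m ℓ i ℓ≤m i≤m))
                                          (fromℕ-* (m C i) ((m ∸ i) C ℓ)))) ⟩
      (c m i * c (m ∸ i) ℓ) * (B ℓ * x ^ i)
        ≡⟨ solve 4 (λ a b d p → (a :* d) :* (b :* p) := a :* p :* (d :* b))
                   refl (c m i) (B ℓ) (c (m ∸ i) ℓ) (x ^ i) ⟩
      c m i * x ^ i * (c (m ∸ i) ℓ * B ℓ) ∎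

  bernoulliPoly-reversed : ∀ m x → bernoulliPoly m x ≡ sum (suc m) (λ i → fromℕ (m C i) * x ^ i * B (m ∸ i))
  bernoulliPoly-reversed m x = trans (sum-reverse (suc m) _) (sum-cong-< (suc m) (λ i i≤m → trans
    (cong₂ (λ c e → fromℕ c * B (m ∸ i) * x ^ e)
           (sym (nCk≡nC[n∸k] (ℕ.≤-pred i≤m))) (ℕ.m∸[m∸n]≡n (ℕ.≤-pred i≤m)))
    (solve 3 (λ a b p → a :* b :* p := a :* p :* b) refl (fromℕ (m C i)) (B (m ∸ i)) (x ^ i))))

  Σ-C-δ₁ : ∀ k x → sum (suc (suc k)) (λ i → fromℕ (suc k C i) * x ^ i * δ₁ (suc k ∸ i)) ≡ fromℕ (suc k) * x ^ k
  Σ-C-δ₁ k x = trans (sum-delta (suc (suc k)) k _ (ℕ.m<n⇒m<1+n (ℕ.n<1+n k)) vanish)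
    (trans (cong₂ (λ c d → fromℕ c * x ^ k * δ₁ d) ([1+n]Cn≡1+n k) (ℕ.m+n∸n≡m 1 k)) (*-identityʳ _))
    where
    vanish : ∀ i → i < suc (suc k) → i ≢ k → fromℕ (suc k C i) * x ^ i * δ₁ (suc k ∸ i) ≡ 0ℚ
    vanish i i≤1+k i≢k =
      trans (cong (fromℕ (suc k C i) * x ^ i *_) (δ₁≡0 _ 1+k∸i≢1)) (*-zeroʳ (fromℕ (suc k C i) * x ^ i))
      where 1+k∸i≢1 : suc k ∸ i ≢ 1
            1+k∸i≢1 e = i≢k (ℕ.suc-injective (trans (cong (ℕ._+ i) (sym e)) (ℕ.m∸n+n≡m (ℕ.≤-pred i≤1+k))))

  bernoulliPoly-suc-+1 : ∀ k x → bernoulliPoly (suc k) (x + 1ℚ) ≡ bernoulliPoly (suc k) x + fromℕ (suc k) * x ^ k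
  bernoulliPoly-suc-+1 k x = begin
    bernoulliPoly m (x + 1ℚ)
      ≡⟨ bernoulliPoly-+1 m x ⟩
    sum (suc m) (λ i → c i * x ^ i * (B (m ∸ i) + δ₁ (m ∸ i)))
      ≡⟨ sum-cong (suc m) (λ i → *-distribˡ-+ (c i * x ^ i) _ _) ⟩
    sum (suc m) (λ i → c i * x ^ i * B (m ∸ i) + c i * x ^ i * δ₁ (m ∸ i))
      ≡⟨ sum-+ (suc m) _ _ ⟩
    sum (suc m) (λ i → c i * x ^ i * B (m ∸ i)) + sum (suc m) (λ i → c i * x ^ i * δ₁ (m ∸ i))
      ≡⟨ cong₂ _+_ (sym (bernoulliPoly-reversed m x)) (Σ-C-δ₁ k x) ⟩
    bernoulliPoly m x + fromℕ (suc k) * x ^ k ∎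
    where
    open ≡-Reasoning
    m = suc k
    c : ℕ → ℚ
    c i = fromℕ (m C i)

module Faulhaber where

  open import Defs using (B; B⁺; signQ)
  open BernoulliNumbers
  open BernoulliPolynomials
  open import Data.Nat as ℕ using (ℕ; zero; suc; _∸_; _≤_; _<_; s≤s)
  import Data.Nat.Properties as ℕ
  open import Data.Nat.Combinatorics using (_C_; nC1≡n)
  open import Data.Rational using (ℚ; _+_; _*_; -_; _-_; 0ℚ; 1ℚ)
  open import Data.Rational.Properties
    using (+-identityˡ; +-identityʳ; +-inverseˡ; *-identityˡ; *-identityʳ; *-zeroˡ; *-zeroʳ; *-assoc; neg-distribˡ-*)
  open import Data.Rational.Solver using (module +-*-Solver)
  open +-*-Solver using (solve; _:+_; _:*_; :-_; _:-_; _:=_; con)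
  open import Relation.Binary.PropositionalEquality

  -- faulhaberPoly k x = B_{k+1}(x) - B_{k+1}, the Bernoulli polynomial without its constant term.
  faulhaberPoly : ℕ → ℚ → ℚ
  faulhaberPoly k x = sum (suc k) (λ ℓ → fromℕ (suc k C ℓ) * B ℓ * x ^ (suc k ∸ ℓ))

  powerSum : ℕ → ℕ → ℚ
  powerSum n k = sum n (λ j → fromℕ j ^ k)

  private
    1+k∸ℓ≡1+[k∸ℓ] : ∀ {k ℓ} → ℓ ≤ k → suc k ∸ ℓ ≡ suc (k ∸ ℓ)
    1+k∸ℓ≡1+[k∸ℓ] ℓ≤k = ℕ.+-∸-assoc 1 ℓ≤k

  faulhaberPoly-+1 : ∀ k x → faulhaberPoly k (x + 1ℚ) ≡ faulhaberPoly k x + fromℕ (suc k) * x ^ k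
  faulhaberPoly-+1 k x = begin
    F (x + 1ℚ)                                    ≡⟨ solve 2 (λ a b → a := (a :+ b) :- b) refl (F (x + 1ℚ)) top ⟩
    (F (x + 1ℚ) + top) - top                      ≡⟨ cong (_- top) (sym (split (x + 1ℚ))) ⟩
    bernoulliPoly (suc k) (x + 1ℚ) - top          ≡⟨ cong (_- top) (bernoulliPoly-suc-+1 k x) ⟩
    (bernoulliPoly (suc k) x + d) - top           ≡⟨ cong (λ b → (b + d) - top) (split x) ⟩
    ((F x + top) + d) - top                       ≡⟨ solve 3 (λ a b c → ((a :+ b) :+ c) :- b := a :+ c)
                                                            refl (F x) top d ⟩
    F x + d                                       ∎
    where
    open ≡-Reasoning
    F = faulhaberPoly k
    top = fromℕ (suc k C suc k) * B (suc k)
    d = fromℕ (suc k) * x ^ k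
    split : ∀ y → bernoulliPoly (suc k) y ≡ faulhaberPoly k y + top
    split y = cong (faulhaberPoly k y +_) (trans (cong (λ e → top * y ^ e) (ℕ.n∸n≡0 k)) (*-identityʳ top))

  faulhaberPoly-+n : ∀ k n x → faulhaberPoly k (x + fromℕ n) ≡
                     faulhaberPoly k x + fromℕ (suc k) * sum n (λ j → (x + fromℕ j) ^ k)
  faulhaberPoly-+n k zero    x = trans (cong (faulhaberPoly k) (+-identityʳ x))
    (solve 2 (λ a b → a := a :+ b :* con 0ℚ) refl (faulhaberPoly k x) (fromℕ (suc k)))
  faulhaberPoly-+n k (suc n) x = begin
    F (x + (1ℚ + fromℕ n))                      ≡⟨ cong F (solve 2 (λ x y → x :+ (con 1ℚ :+ y) := (x :+ y) :+ con 1ℚ)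
                                                                   refl x (fromℕ n)) ⟩
    F ((x + fromℕ n) + 1ℚ)                      ≡⟨ faulhaberPoly-+1 k (x + fromℕ n) ⟩
    F (x + fromℕ n) + a * (x + fromℕ n) ^ k     ≡⟨ cong (_+ a * (x + fromℕ n) ^ k) (faulhaberPoly-+n k n x) ⟩
    F x + a * S + a * (x + fromℕ n) ^ k         ≡⟨ solve 4 (λ f a s t → f :+ a :* s :+ a :* t := f :+ a :* (s :+ t))
                                                          refl (F x) a S ((x + fromℕ n) ^ k) ⟩
    F x + a * sum (suc n) (λ j → (x + fromℕ j) ^ k) ∎
    where
    open ≡-Reasoning
    F = faulhaberPoly k
    a = fromℕ (suc k)
    S = sum n (λ j → (x + fromℕ j) ^ k)

  faulhaberPoly-0 : ∀ k → faulhaberPoly k 0ℚ ≡ 0ℚ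
  faulhaberPoly-0 k = sum-zero (suc k) _ (λ ℓ ℓ≤k → trans
    (cong (λ e → fromℕ (suc k C ℓ) * B ℓ * 0ℚ ^ e) (1+k∸ℓ≡1+[k∸ℓ] (ℕ.≤-pred ℓ≤k)))
    (trans (cong (fromℕ (suc k C ℓ) * B ℓ *_) (*-zeroˡ (0ℚ ^ (k ∸ ℓ))))
           (*-zeroʳ (fromℕ (suc k C ℓ) * B ℓ))))

  faulhaberPoly-fromℕ : ∀ k n → faulhaberPoly k (fromℕ n) ≡ fromℕ (suc k) * powerSum n k
  faulhaberPoly-fromℕ k n = begin
    faulhaberPoly k (fromℕ n)                  ≡⟨ cong (faulhaberPoly k) (sym (+-identityˡ (fromℕ n))) ⟩
    faulhaberPoly k (0ℚ + fromℕ n)             ≡⟨ faulhaberPoly-+n k n 0ℚ ⟩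
    faulhaberPoly k 0ℚ + fromℕ (suc k) * sum n (λ j → (0ℚ + fromℕ j) ^ k)
      ≡⟨ cong₂ (λ a b → a + fromℕ (suc k) * b) (faulhaberPoly-0 k)
               (sum-cong n (λ j → cong (_^ k) (+-identityˡ (fromℕ j)))) ⟩
    0ℚ + fromℕ (suc k) * powerSum n k          ≡⟨ +-identityˡ _ ⟩
    fromℕ (suc k) * powerSum n k               ∎
    where open ≡-Reasoning

  faulhaber⁺ : ∀ k n → 1 ≤ k →
    fromℕ n * sum (suc k) (λ ℓ → fromℕ (suc k C ℓ) * B⁺ ℓ * fromℕ n ^ (k ∸ ℓ)) ≡
    fromℕ (suc k) * powerSum (suc n) k
  faulhaber⁺ k n 1≤k = begin
    y * sum (suc k) (λ ℓ → c ℓ * B⁺ ℓ * y ^ (k ∸ ℓ))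
      ≡⟨ *-distribˡ-sum (suc k) y _ ⟩
    sum (suc k) (λ ℓ → y * (c ℓ * B⁺ ℓ * y ^ (k ∸ ℓ)))
      ≡⟨ sum-cong-< (suc k) (λ ℓ ℓ≤k → split ℓ (ℕ.≤-pred ℓ≤k)) ⟩
    sum (suc k) (λ ℓ → c ℓ * B ℓ * y ^ (suc k ∸ ℓ) + c ℓ * y ^ (suc k ∸ ℓ) * δ₁ ℓ)
      ≡⟨ sum-+ (suc k) _ _ ⟩
    faulhaberPoly k y + sum (suc k) (λ ℓ → c ℓ * y ^ (suc k ∸ ℓ) * δ₁ ℓ)
      ≡⟨ cong₂ _+_ (faulhaberPoly-fromℕ k n) (sum-delta (suc k) 1 _ (s≤s 1≤k) (λ ℓ _ → off-1 ℓ)) ⟩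
    fromℕ (suc k) * powerSum n k + c 1 * y ^ k * 1ℚ
      ≡⟨ cong (λ m → fromℕ (suc k) * powerSum n k + fromℕ m * y ^ k * 1ℚ) (nC1≡n (suc k)) ⟩
    fromℕ (suc k) * powerSum n k + fromℕ (suc k) * y ^ k * 1ℚ
      ≡⟨ solve 3 (λ a b c → a :* b :+ a :* c :* con 1ℚ := a :* (b :+ c))
                 refl (fromℕ (suc k)) (powerSum n k) (y ^ k) ⟩
    fromℕ (suc k) * powerSum (suc n) k ∎
    where
    open ≡-Reasoning
    y = fromℕ n
    c : ℕ → ℚ
    c ℓ = fromℕ (suc k C ℓ)
    off-1 : ∀ ℓ → ℓ ≢ 1 → c ℓ * y ^ (suc k ∸ ℓ) * δ₁ ℓ ≡ 0ℚ
    off-1 ℓ ℓ≢1 = trans (cong (c ℓ * y ^ (suc k ∸ ℓ) *_) (δ₁≡0 ℓ ℓ≢1)) (*-zeroʳ (c ℓ * y ^ (suc k ∸ ℓ)))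
    split : ∀ ℓ → ℓ ≤ k →
            y * (c ℓ * B⁺ ℓ * y ^ (k ∸ ℓ)) ≡ c ℓ * B ℓ * y ^ (suc k ∸ ℓ) + c ℓ * y ^ (suc k ∸ ℓ) * δ₁ ℓ
    split ℓ ℓ≤k = begin
      y * (c ℓ * B⁺ ℓ * y ^ (k ∸ ℓ))
        ≡⟨ cong (λ b → y * (c ℓ * b * y ^ (k ∸ ℓ))) (B⁺≡B+δ₁ ℓ) ⟩
      y * (c ℓ * (B ℓ + δ₁ ℓ) * y ^ (k ∸ ℓ))
        ≡⟨ solve 5 (λ y c b d p → y :* (c :* (b :+ d) :* p) := c :* b :* (y :* p) :+ c :* (y :* p) :* d)
                 refl y (c ℓ) (B ℓ) (δ₁ ℓ) (y ^ (k ∸ ℓ)) ⟩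
      c ℓ * B ℓ * y ^ suc (k ∸ ℓ) + c ℓ * y ^ suc (k ∸ ℓ) * δ₁ ℓ
        ≡⟨ cong (λ e → c ℓ * B ℓ * y ^ e + c ℓ * y ^ e * δ₁ ℓ) (sym (1+k∸ℓ≡1+[k∸ℓ] ℓ≤k)) ⟩
      c ℓ * B ℓ * y ^ (suc k ∸ ℓ) + c ℓ * y ^ (suc k ∸ ℓ) * δ₁ ℓ ∎

  powerSum-suc : ∀ n k → 1 ≤ k → powerSum (suc n) k ≡ sum n (λ i → fromℕ (suc i) ^ k)
  powerSum-suc n (suc k) _ = trans (sum-head n (λ j → fromℕ j ^ suc k))
    (trans (cong (_+ sum n (λ i → fromℕ (suc i) ^ suc k)) (*-zeroˡ (0ℚ ^ k))) (+-identityˡ _))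

  signQ-+ : ∀ a b → signQ (a ℕ.+ b) ≡ signQ a * signQ b
  signQ-+ zero    b = sym (*-identityˡ _)
  signQ-+ (suc a) b = trans (cong -_ (signQ-+ a b)) (neg-distribˡ-* (signQ a) (signQ b))

  signQ*signQ≡1 : ∀ a → signQ a * signQ a ≡ 1ℚ
  signQ*signQ≡1 zero    = refl
  signQ*signQ≡1 (suc a) = trans (solve 1 (λ s → (:- s) :* (:- s) := s :* s) refl (signQ a)) (signQ*signQ≡1 a)

  neg-^ : ∀ y e → (- y) ^ e ≡ signQ e * y ^ e
  neg-^ y zero    = refl
  neg-^ y (suc e) = trans (cong (- y *_) (neg-^ y e))
    (solve 3 (λ y s p → (:- y) :* (s :* p) := (:- s) :* (y :* p)) refl y (signQ e) (y ^ e))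

  signQ≡-1⇒1≤k : ∀ {k} → signQ k ≡ - 1ℚ → 1 ≤ k
  signQ≡-1⇒1≤k {zero}  ()
  signQ≡-1⇒1≤k {suc k} _ = s≤s ℕ.z≤n

  module _ (k : ℕ) (k-odd : signQ k ≡ - 1ℚ) where

    signQ-reflect : ∀ ℓ → ℓ ≤ suc k → signQ (suc k ∸ ℓ) ≡ signQ ℓ
    signQ-reflect ℓ ℓ≤1+k = begin
      signQ (suc k ∸ ℓ)                       ≡⟨ *-identityʳ _ ⟨
      signQ (suc k ∸ ℓ) * 1ℚ                  ≡⟨ cong (signQ (suc k ∸ ℓ) *_) (signQ*signQ≡1 ℓ) ⟨
      signQ (suc k ∸ ℓ) * (signQ ℓ * signQ ℓ) ≡⟨ *-assoc (signQ (suc k ∸ ℓ)) (signQ ℓ) (signQ ℓ) ⟨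
      signQ (suc k ∸ ℓ) * signQ ℓ * signQ ℓ   ≡⟨ cong (_* signQ ℓ) (signQ-+ (suc k ∸ ℓ) ℓ) ⟨
      signQ (suc k ∸ ℓ ℕ.+ ℓ) * signQ ℓ       ≡⟨ cong (λ e → signQ e * signQ ℓ) (ℕ.m∸n+n≡m ℓ≤1+k) ⟩
      - signQ k * signQ ℓ                     ≡⟨ cong (λ s → - s * signQ ℓ) k-odd ⟩
      - - 1ℚ * signQ ℓ                        ≡⟨ *-identityˡ _ ⟩
      signQ ℓ                                 ∎
      where open ≡-Reasoning

    private
      shifted-powers : ∀ n → sum n (λ j → (- fromℕ n + fromℕ j) ^ k) ≡ - sum n (λ i → fromℕ (suc i) ^ k)
      shifted-powers n = begin
        sum n (λ j → (- fromℕ n + fromℕ j) ^ k)          ≡⟨ sum-reverse n _ ⟩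
        sum n (λ i → (- fromℕ n + fromℕ (n ∸ suc i)) ^ k) ≡⟨ sum-cong-< n term ⟩
        sum n (λ i → - 1ℚ * fromℕ (suc i) ^ k)            ≡⟨ *-distribˡ-sum n (- 1ℚ) _ ⟨
        - 1ℚ * sum n (λ i → fromℕ (suc i) ^ k)            ≡⟨ solve 1 (λ a → (:- con 1ℚ) :* a := :- a) refl _ ⟩
        - sum n (λ i → fromℕ (suc i) ^ k)                 ∎
        where
        open ≡-Reasoning
        term : ∀ i → i < n → (- fromℕ n + fromℕ (n ∸ suc i)) ^ k ≡ - 1ℚ * fromℕ (suc i) ^ k
        term i i<n = begin
          (- fromℕ n + fromℕ (n ∸ suc i)) ^ k
            ≡⟨ cong (λ z → (- z + fromℕ (n ∸ suc i)) ^ k)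
                    (trans (cong fromℕ (sym (ℕ.m∸n+n≡m i<n))) (fromℕ-+ (n ∸ suc i) (suc i))) ⟩
          (- (fromℕ (n ∸ suc i) + fromℕ (suc i)) + fromℕ (n ∸ suc i)) ^ k
            ≡⟨ cong (_^ k) (solve 2 (λ a b → (:- (a :+ b)) :+ a := :- b)
                                    refl (fromℕ (n ∸ suc i)) (fromℕ (suc i))) ⟩
          (- fromℕ (suc i)) ^ k                  ≡⟨ neg-^ (fromℕ (suc i)) k ⟩
          signQ k * fromℕ (suc i) ^ k            ≡⟨ cong (_* fromℕ (suc i) ^ k) k-odd ⟩
          - 1ℚ * fromℕ (suc i) ^ k               ∎

    faulhaberPoly-neg : ∀ n → faulhaberPoly k (- fromℕ n) ≡ fromℕ (suc k) * sum n (λ i → fromℕ (suc i) ^ k)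
    faulhaberPoly-neg n = begin
      F (- y)
        ≡⟨ solve 3 (λ f a p → f := (f :+ a :* (:- p)) :+ a :* p) refl (F (- y)) a P ⟩
      (F (- y) + a * (- P)) + a * P
        ≡⟨ cong (λ z → (F (- y) + a * z) + a * P) (shifted-powers n) ⟨
      (F (- y) + a * sum n (λ j → (- y + fromℕ j) ^ k)) + a * P
        ≡⟨ cong (_+ a * P) (faulhaberPoly-+n k n (- y)) ⟨
      F (- y + y) + a * P ≡⟨ cong (λ z → F z + a * P) (+-inverseˡ y) ⟩
      F 0ℚ + a * P        ≡⟨ cong (_+ a * P) (faulhaberPoly-0 k) ⟩
      0ℚ + a * P          ≡⟨ +-identityˡ _ ⟩
      a * P               ∎
      where
      open ≡-Reasoning
      F = faulhaberPoly k
      y = fromℕ n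
      a = fromℕ (suc k)
      P = sum n (λ i → fromℕ (suc i) ^ k)

    faulhaber⁻ : ∀ n →
      fromℕ n * sum (suc k) (λ ℓ → signQ ℓ * B ℓ * fromℕ (suc k C ℓ) * fromℕ n ^ (k ∸ ℓ)) ≡
      fromℕ (suc k) * powerSum (suc n) k
    faulhaber⁻ n = begin
      y * sum (suc k) (λ ℓ → signQ ℓ * B ℓ * c ℓ * y ^ (k ∸ ℓ))
        ≡⟨ *-distribˡ-sum (suc k) y _ ⟩
      sum (suc k) (λ ℓ → y * (signQ ℓ * B ℓ * c ℓ * y ^ (k ∸ ℓ)))
        ≡⟨ sum-cong-< (suc k) (λ ℓ ℓ≤k → reflect ℓ (ℕ.≤-pred ℓ≤k)) ⟩
      faulhaberPoly k (- y)
        ≡⟨ faulhaberPoly-neg n ⟩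
      fromℕ (suc k) * sum n (λ i → fromℕ (suc i) ^ k)
        ≡⟨ cong (fromℕ (suc k) *_) (powerSum-suc n k (signQ≡-1⇒1≤k k-odd)) ⟨
      fromℕ (suc k) * powerSum (suc n) k ∎
      where
      open ≡-Reasoning
      y = fromℕ n
      c : ℕ → ℚ
      c ℓ = fromℕ (suc k C ℓ)
      reflect : ∀ ℓ → ℓ ≤ k → y * (signQ ℓ * B ℓ * c ℓ * y ^ (k ∸ ℓ)) ≡ c ℓ * B ℓ * (- y) ^ (suc k ∸ ℓ)
      reflect ℓ ℓ≤k = begin
        y * (signQ ℓ * B ℓ * c ℓ * y ^ (k ∸ ℓ))
          ≡⟨ solve 5 (λ y s b c p → y :* (s :* b :* c :* p) := c :* b :* (s :* (y :* p)))
                     refl y (signQ ℓ) (B ℓ) (c ℓ) (y ^ (k ∸ ℓ)) ⟩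
        c ℓ * B ℓ * (signQ ℓ * y ^ suc (k ∸ ℓ))
          ≡⟨ cong₂ (λ s e → c ℓ * B ℓ * (s * y ^ e))
                   (sym (signQ-reflect ℓ (ℕ.m≤n⇒m≤1+n ℓ≤k))) (sym (1+k∸ℓ≡1+[k∸ℓ] ℓ≤k)) ⟩
        c ℓ * B ℓ * (signQ (suc k ∸ ℓ) * y ^ (suc k ∸ ℓ))
          ≡⟨ cong (c ℓ * B ℓ *_) (neg-^ y (suc k ∸ ℓ)) ⟨
        c ℓ * B ℓ * (- y) ^ (suc k ∸ ℓ) ∎

  signQ-odd : ∀ t → signQ (suc (t ℕ.+ t)) ≡ - 1ℚ
  signQ-odd t = cong -_ (trans (signQ-+ t t) (signQ*signQ≡1 t))

module SumsAsPowerSums where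

  open import Defs
  open NaturalPowerSums using (powerSumℕ)
  open BernoulliNumbers
  open Faulhaber
  open import Data.Nat as ℕ using (ℕ; suc; _∸_; _≤_)
  open import Data.Nat.Combinatorics using (_C_)
  open import Data.Rational using (ℚ; _*_; -_; 1ℚ)
  open import Data.Rational.Properties using (*-identityˡ; *-assoc)
  open import Data.Rational.Solver using (module +-*-Solver)
  open +-*-Solver using (solve; _:*_; _:=_; con)
  open import Relation.Binary.PropositionalEquality

  private
    powShift≡ : ∀ n k ℓ → powShift (suc n) k ℓ ≡ fromℕ (suc n) ^ (k ∸ ℓ) * invℕ (suc n)
    powShift≡ n k ℓ =
      cong (_* invℕ (suc n)) (trans (ℕtoℚ≡fromℕ (suc n ℕ.^ (k ∸ ℓ))) (fromℕ-^ (suc n) (k ∸ ℓ)))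

    factor-out : ∀ n k (f : ℕ → ℚ) →
      invℕ (suc k) * sumQ (suc k) (λ ℓ → f ℓ * powShift (suc n) k ℓ) ≡
      invℕ (suc k) * (sum (suc k) (λ ℓ → f ℓ * fromℕ (suc n) ^ (k ∸ ℓ)) * invℕ (suc n))
    factor-out n k f = cong (invℕ (suc k) *_) (trans (sumQ≡sum (suc k) _)
      (trans (sum-cong (suc k) (λ ℓ → trans (cong (f ℓ *_) (powShift≡ n k ℓ)) (sym (*-assoc (f ℓ) _ _))))
             (sym (*-distribʳ-sum (suc k) (invℕ (suc n)) _))))

    divide-out : ∀ n k c Z → fromℕ (suc n) * Z ≡ fromℕ (suc k) * fromℕ (suc n ℕ.* suc n ℕ.* c) →
                 invℕ (suc k) * (Z * invℕ (suc n)) ≡ ℕtoℚ c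
    divide-out n k c Z nZ≡[k+1]W = begin
      a * (Z * u)                           ≡⟨ cong (λ z → a * (z * u)) Z≡u*[v*Z] ⟩
      a * (u * (v * Z) * u)                 ≡⟨ cong (λ z → a * (u * z * u)) nZ≡[k+1]W ⟩
      a * (u * (b * W) * u)                 ≡⟨ cong (λ w → a * (u * (b * w) * u)) W≡v*v*c ⟩
      a * (u * (b * (v * v * fromℕ c)) * u) ≡⟨ solve 5 (λ a b u v c → a :* (u :* (b :* (v :* v :* c)) :* u) :=
                                                                     (a :* b) :* (u :* v) :* (u :* v) :* c)
                                                       refl a b u v (fromℕ c) ⟩
      (a * b) * (u * v) * (u * v) * fromℕ c ≡⟨ cong₂ (λ p q → p * q * q * fromℕ c) (invℕ-inverseˡ k) (invℕ-inverseˡ n) ⟩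
      1ℚ * 1ℚ * 1ℚ * fromℕ c                ≡⟨ solve 1 (λ c → con 1ℚ :* con 1ℚ :* con 1ℚ :* c := c) refl (fromℕ c) ⟩
      fromℕ c                               ≡⟨ ℕtoℚ≡fromℕ c ⟨
      ℕtoℚ c                                ∎
      where
      open ≡-Reasoning
      a = invℕ (suc k)
      b = fromℕ (suc k)
      u = invℕ (suc n)
      v = fromℕ (suc n)
      W = fromℕ (suc n ℕ.* suc n ℕ.* c)
      Z≡u*[v*Z] : Z ≡ u * (v * Z)
      Z≡u*[v*Z] = trans (sym (*-identityˡ Z)) (trans (cong (_* Z) (sym (invℕ-inverseˡ n))) (*-assoc u v Z))
      W≡v*v*c : W ≡ v * v * fromℕ c
      W≡v*v*c = trans (fromℕ-* (suc n ℕ.* suc n) c) (cong (_* fromℕ c) (fromℕ-* (suc n) (suc n)))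

    powerSum≡ : ∀ n k c → powerSumℕ (suc (suc n)) k ≡ suc n ℕ.* suc n ℕ.* c →
                powerSum (suc (suc n)) k ≡ fromℕ (suc n ℕ.* suc n ℕ.* c)
    powerSum≡ n k c eq = trans (sym (fromℕ-powerSumℕ (suc (suc n)) k)) (cong fromℕ eq)

  S⁺-value : ∀ n k c → 1 ≤ k → powerSumℕ (suc (suc n)) k ≡ suc n ℕ.* suc n ℕ.* c → S⁺ (suc n) k ≡ ℕtoℚ c
  S⁺-value n k c 1≤k T≡n²c =
    trans (factor-out n k (λ ℓ → ℕtoℚ (suc k C ℓ) * B⁺ ℓ)) (divide-out n k c _ (begin
      y * sum (suc k) (λ ℓ → ℕtoℚ (suc k C ℓ) * B⁺ ℓ * y ^ (k ∸ ℓ))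
        ≡⟨ cong (y *_) (sum-cong (suc k) (λ ℓ → cong (λ x → x * B⁺ ℓ * y ^ (k ∸ ℓ)) (ℕtoℚ≡fromℕ (suc k C ℓ)))) ⟩
      y * sum (suc k) (λ ℓ → fromℕ (suc k C ℓ) * B⁺ ℓ * y ^ (k ∸ ℓ))
        ≡⟨ faulhaber⁺ k (suc n) 1≤k ⟩
      fromℕ (suc k) * powerSum (suc (suc n)) k
        ≡⟨ cong (fromℕ (suc k) *_) (powerSum≡ n k c T≡n²c) ⟩
      fromℕ (suc k) * fromℕ (suc n ℕ.* suc n ℕ.* c) ∎))
    where
    open ≡-Reasoning
    y = fromℕ (suc n)

  S⁻-value : ∀ n k c → signQ k ≡ - 1ℚ → powerSumℕ (suc (suc n)) k ≡ suc n ℕ.* suc n ℕ.* c → S⁻ (suc n) k ≡ ℕtoℚ c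
  S⁻-value n k c k-odd T≡n²c =
    trans (factor-out n k (λ ℓ → signQ ℓ * B ℓ * ℕtoℚ (suc k C ℓ))) (divide-out n k c _ (begin
      y * sum (suc k) (λ ℓ → signQ ℓ * B ℓ * ℕtoℚ (suc k C ℓ) * y ^ (k ∸ ℓ))
        ≡⟨ cong (y *_) (sum-cong (suc k) (λ ℓ →
             cong (λ x → signQ ℓ * B ℓ * x * y ^ (k ∸ ℓ)) (ℕtoℚ≡fromℕ (suc k C ℓ)))) ⟩
      y * sum (suc k) (λ ℓ → signQ ℓ * B ℓ * fromℕ (suc k C ℓ) * y ^ (k ∸ ℓ))
        ≡⟨ faulhaber⁻ k k-odd (suc n) ⟩
      fromℕ (suc k) * powerSum (suc (suc n)) k
        ≡⟨ cong (fromℕ (suc k) *_) (powerSum≡ n k c T≡n²c) ⟩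
      fromℕ (suc k) * fromℕ (suc n ℕ.* suc n ℕ.* c) ∎))
    where
    open ≡-Reasoning
    y = fromℕ (suc n)

module IntegerPowerSums where

  open import Data.Nat as ℕ using (ℕ; zero; suc; _∸_; _≤_; _<_)
  import Data.Nat.Properties as ℕ
  import Data.Nat.Divisibility as ℕ
  import Data.Nat.Coprimality as ℕ
  open import Data.Integer as ℤ using (ℤ; +_; _+_; _*_; -_; _-_; 0ℤ; 1ℤ)
  import Data.Integer.Properties as ℤ
  open import Data.Integer.Divisibility.Signed
  open import Data.Integer.Coprimality using (coprime-divisor)
  open import Data.Integer.Tactic.RingSolver using (solve-∀)
  open import Data.Nat.Combinatorics using (_C_; nCn≡1)
  open import Relation.Binary.PropositionalEquality

  open RangeSums ℤ.+-*-commutativeSemiring public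

  ∣-sum : ∀ {d} m f → (∀ i → i < m → d ∣ f i) → d ∣ sum m f
  ∣-sum zero    f d∣f = ∣ᵤ⇒∣ (ℕ._∣0 _)
  ∣-sum (suc m) f d∣f = ∣m∣n⇒∣m+n (∣-sum m f (λ i i<m → d∣f i (ℕ.m<n⇒m<1+n i<m))) (d∣f m ℕ.≤-refl)

  sum-diff : ∀ m f g → sum m (λ i → f i - g i) ≡ sum m f - sum m g
  sum-diff m f g = begin
    sum m (λ i → f i - g i)                       ≡⟨ add-sub (sum m (λ i → f i - g i)) (sum m g) ⟩
    (sum m (λ i → f i - g i) + sum m g) - sum m g ≡⟨ cong (_- sum m g) (sym (sum-+ m _ g)) ⟩
    sum m (λ i → (f i - g i) + g i) - sum m g     ≡⟨ cong (_- sum m g) (sum-cong m (λ i → sub-add (f i) (g i))) ⟩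
    sum m f - sum m g                             ∎
    where
    open ≡-Reasoning
    add-sub : ∀ a b → a ≡ (a + b) - b
    add-sub = solve-∀
    sub-add : ∀ a b → (a - b) + b ≡ a
    sub-add = solve-∀

  ∣-sum-diff : ∀ {d} m f g → (∀ i → i < m → d ∣ f i - g i) → d ∣ sum m f - sum m g
  ∣-sum-diff m f g d∣f-g = subst (_ ∣_) (sum-diff m f g) (∣-sum m _ d∣f-g)

  ∣-diff-trans : ∀ {d x y z} → d ∣ x - y → d ∣ y - z → d ∣ x - z
  ∣-diff-trans {d} {x} {y} {z} d∣x-y d∣y-z = subst (d ∣_) (telescope x y z) (∣m∣n⇒∣m+n d∣x-y d∣y-z)
    where telescope : ∀ x y z → (x - y) + (y - z) ≡ x - z
          telescope = solve-∀

  coprime-divisorℤ : ∀ {d a} z → ℕ.Coprime d a → (+ d) ∣ (+ a) * z → (+ d) ∣ z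
  coprime-divisorℤ {d} {a} z d⊥a d∣az = ∣ᵤ⇒∣ (coprime-divisor (+ d) (+ a) z d⊥a (∣⇒∣ᵤ d∣az))

  powerSumℤ : ℕ → ℕ → ℤ
  powerSumℤ N m = sum N (λ j → (+ j) ^ m)

  y²∣[x+y]^[m+1]-x^[m+1]-[m+1]yx^m : ∀ x y m → (y * y) ∣ (x + y) ^ suc m - x ^ suc m - (+ suc m) * y * x ^ m
  y²∣[x+y]^[m+1]-x^[m+1]-[m+1]yx^m x y zero = subst (_ ∣_) (sym (vanishes x y)) (∣ᵤ⇒∣ (ℕ._∣0 _))
    where vanishes : ∀ x y → (x + y) * 1ℤ - x * 1ℤ - (+ 1) * y * 1ℤ ≡ 0ℤ
          vanishes = solve-∀
  y²∣[x+y]^[m+1]-x^[m+1]-[m+1]yx^m x y (suc m) = subst (_ ∣_) (sym step)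
    (∣m∣n⇒∣m+n (∣n⇒∣m*n (x + y) (y²∣[x+y]^[m+1]-x^[m+1]-[m+1]yx^m x y m)) (∣m⇒∣m*n ((+ suc m) * x ^ m) ∣-refl))
    where
    step : (x + y) ^ suc (suc m) - x ^ suc (suc m) - (+ suc (suc m)) * y * x ^ suc m ≡
           (x + y) * ((x + y) ^ suc m - x ^ suc m - (+ suc m) * y * x ^ m) + (y * y) * ((+ suc m) * x ^ m)
    step = identity x y ((x + y) ^ suc m) (x ^ m) (+ suc m)
      where identity : ∀ x y A P s → (x + y) * A - x * (x * P) - (1ℤ + s) * y * (x * P) ≡
                                     (x + y) * (A - x * P - s * y * P) + (y * y) * (s * P)
            identity = solve-∀

  -^-odd : ∀ x t → (- x) ^ suc (t ℕ.+ t) ≡ - x ^ suc (t ℕ.+ t)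
  -^-odd x zero    = identity x
    where identity : ∀ x → (- x) * 1ℤ ≡ - (x * 1ℤ)
          identity = solve-∀
  -^-odd x (suc t) = begin
    (- x) ^ suc (suc t ℕ.+ suc t)          ≡⟨ cong ((- x) ^_) (cong suc (ℕ.+-suc (suc t) t)) ⟩
    (- x) * ((- x) * (- x) ^ suc (t ℕ.+ t)) ≡⟨ cong (λ z → (- x) * ((- x) * z)) (-^-odd x t) ⟩
    (- x) * ((- x) * (- x ^ suc (t ℕ.+ t))) ≡⟨ identity x (x ^ suc (t ℕ.+ t)) ⟩
    - (x * (x * x ^ suc (t ℕ.+ t)))         ≡⟨ cong (λ e → - x ^ e) (cong suc (ℕ.+-suc (suc t) t)) ⟨
    - x ^ suc (suc t ℕ.+ suc t)            ∎
    where
    open ≡-Reasoning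
    identity : ∀ x p → (- x) * ((- x) * (- p)) ≡ - (x * (x * p))
    identity = solve-∀

  +[n∸i]≡-[i-n] : ∀ n i → i ≤ n → + (n ∸ i) ≡ - (+ i - + n)
  +[n∸i]≡-[i-n] n i i≤n =
    trans (sym (ℤ.⊖-≥ i≤n)) (trans (sym (ℤ.m-n≡m⊖n n i)) (identity (+ n) (+ i)))
    where identity : ∀ a b → a - b ≡ - (b - a)
          identity = solve-∀

  -- Pairing j with n - j: for odd k, j^k + (n-j)^k ≡ k n j^(k-1) (mod n²).
  n²∣2T-knU : ∀ n t → let k = suc (t ℕ.+ t) in
    (+ n) * (+ n) ∣ (+ 2) * powerSumℤ (suc n) k - (+ k) * (+ n) * powerSumℤ (suc n) (t ℕ.+ t)
  n²∣2T-knU n t = subst (_ ∣_) (sym paired) (∣-sum (suc n) _ (λ i i≤n → pair-term i (ℕ.≤-pred i≤n)))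
    where
    k = suc (t ℕ.+ t)
    T = powerSumℤ (suc n) k
    U = powerSumℤ (suc n) (t ℕ.+ t)
    f : ℕ → ℤ
    f i = (+ i) ^ k + (+ (n ∸ i)) ^ k - (+ k) * (+ n) * (+ i) ^ (t ℕ.+ t)
    paired : (+ 2) * T - (+ k) * (+ n) * U ≡ sum (suc n) f
    paired = begin
      (+ 2) * T - (+ k) * (+ n) * U
        ≡⟨ double T ((+ k) * (+ n)) U ⟩
      (T + T) - (+ k) * (+ n) * U
        ≡⟨ cong₂ (λ a b → (T + a) - b) (sum-reverse (suc n) _) (*-distribˡ-sum (suc n) ((+ k) * (+ n)) _) ⟩
      (T + sum (suc n) (λ i → (+ (n ∸ i)) ^ k)) - sum (suc n) (λ i → (+ k) * (+ n) * (+ i) ^ (t ℕ.+ t))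
        ≡⟨ cong (_- sum (suc n) (λ i → (+ k) * (+ n) * (+ i) ^ (t ℕ.+ t))) (sym (sum-+ (suc n) _ _)) ⟩
      sum (suc n) (λ i → (+ i) ^ k + (+ (n ∸ i)) ^ k) - sum (suc n) (λ i → (+ k) * (+ n) * (+ i) ^ (t ℕ.+ t))
        ≡⟨ sym (sum-diff (suc n) _ _) ⟩
      sum (suc n) f ∎
      where
      open ≡-Reasoning
      double : ∀ T a U → (+ 2) * T - a * U ≡ (T + T) - a * U
      double = solve-∀
    pair-term : ∀ i → i ≤ n → (+ n) * (+ n) ∣ f i
    pair-term i i≤n = subst (_ ∣_) (sym f≡) (subst (λ d → d ∣ - E) (square-neg (+ n))
                        (∣m⇒∣-m (y²∣[x+y]^[m+1]-x^[m+1]-[m+1]yx^m (+ i) (- (+ n)) (t ℕ.+ t))))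
      where
      square-neg : ∀ a → (- a) * (- a) ≡ a * a
      square-neg = solve-∀
      P = (+ i + - (+ n)) ^ k
      [n∸i]^k≡-P : (+ (n ∸ i)) ^ k ≡ - P
      [n∸i]^k≡-P = trans (cong (_^ k) (+[n∸i]≡-[i-n] n i i≤n)) (-^-odd (+ i + - (+ n)) t)
      E = P - (+ i) ^ k - (+ k) * (- (+ n)) * (+ i) ^ (t ℕ.+ t)
      f≡ : f i ≡ - E
      f≡ = trans (cong (λ z → (+ i) ^ k + z - (+ k) * (+ n) * (+ i) ^ (t ℕ.+ t)) [n∸i]^k≡-P)
                 (identity ((+ i) ^ k) P ((+ i) ^ (t ℕ.+ t)) (+ k) (+ n))
        where identity : ∀ a P Q K N → a + (- P) - K * N * Q ≡ - (P - a - K * (- N) * Q)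
              identity = solve-∀

  sum-const : ∀ N c → sum N (λ _ → c) ≡ (+ N) * c
  sum-const zero    c = sym (ℤ.*-zeroˡ c)
  sum-const (suc N) c = trans (cong (_+ c) (sum-const N c)) (identity (+ N) c)
    where identity : ∀ n c → n * c + c ≡ (1ℤ + n) * c
          identity = solve-∀

  powerSumℤ-0 : ∀ N → powerSumℤ N 0 ≡ + N
  powerSumℤ-0 N = trans (sum-const N 1ℤ) (ℤ.*-identityʳ (+ N))

  sum-telescope : ∀ (g : ℕ → ℤ) N → sum N (λ j → g (suc j) - g j) ≡ g N - g 0
  sum-telescope g zero    = sym (ℤ.+-inverseʳ (g 0))
  sum-telescope g (suc N) = trans (cong (_+ (g (suc N) - g N)) (sum-telescope g N)) (identity (g N) (g 0) (g (suc N)))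
    where identity : ∀ a b c → (a - b) + (c - a) ≡ c - b
          identity = solve-∀

  2*Σt≡P*[P-1] : ∀ P → (+ 2) * sum P (λ t → + t) ≡ (+ P) * (+ P - 1ℤ)
  2*Σt≡P*[P-1] zero    = refl
  2*Σt≡P*[P-1] (suc P) = trans (ℤ.*-distribˡ-+ (+ 2) (sum P (λ t → + t)) (+ P))
                               (trans (cong (_+ (+ 2) * (+ P)) (2*Σt≡P*[P-1] P)) (identity (+ P)))
    where identity : ∀ x → x * (x - 1ℤ) + (+ 2) * x ≡ (1ℤ + x) * ((1ℤ + x) - 1ℤ)
          identity = solve-∀

  -- Expanding (j+1)^(r+1) - j^(r+1) binomially and telescoping over j < N.
  powerSum-recurrence : ∀ r N → sum (suc r) (λ i → fromℕ (suc r C i) * powerSumℤ N i) ≡ (+ N) ^ suc r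
  powerSum-recurrence r N = begin
    sum (suc r) (λ i → c i * powerSumℤ N i)               ≡⟨ sum-cong (suc r) (λ i → *-distribˡ-sum N (c i) _) ⟩
    sum (suc r) (λ i → sum N (λ j → c i * (+ j) ^ i))      ≡⟨ sum-comm N (suc r) (λ j i → c i * (+ j) ^ i) ⟨
    sum N (λ j → sum (suc r) (λ i → c i * (+ j) ^ i))      ≡⟨ sum-cong N (λ j → sym (difference j)) ⟩
    sum N (λ j → g (suc j) - g j)                          ≡⟨ sum-telescope g N ⟩
    g N - g 0                                              ≡⟨ cong (λ z → g N - z) (ℤ.*-zeroˡ (0ℤ ^ r)) ⟩
    g N - 0ℤ                                               ≡⟨ ℤ.+-identityʳ (g N) ⟩
    (+ N) ^ suc r                                          ∎
    where
    open ≡-Reasoning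
    c : ℕ → ℤ
    c i = fromℕ (suc r C i)
    g : ℕ → ℤ
    g j = (+ j) ^ suc r
    difference : ∀ j → g (suc j) - g j ≡ sum (suc r) (λ i → c i * (+ j) ^ i)
    difference j = begin
      g (suc j) - g j                                          ≡⟨ cong (λ z → z ^ suc r - g j) (ℤ.+-comm 1ℤ (+ j)) ⟩
      (+ j + 1ℤ) ^ suc r - g j                                 ≡⟨ cong (_- g j) (binomial (suc r) (+ j)) ⟩
      (sum (suc r) (λ i → c i * (+ j) ^ i) + fromℕ (suc r C suc r) * g j) - g j
        ≡⟨ cong (λ u → (sum (suc r) (λ i → c i * (+ j) ^ i) + fromℕ u * g j) - g j) (nCn≡1 (suc r)) ⟩
      (sum (suc r) (λ i → c i * (+ j) ^ i) + (+ 1) * g j) - g j ≡⟨ identity _ (g j) ⟩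
      sum (suc r) (λ i → c i * (+ j) ^ i)                      ∎
      where identity : ∀ S P → (S + (+ 1) * P) - P ≡ S
            identity = solve-∀

  fromℕ≡+ : ∀ a → fromℕ a ≡ + a
  fromℕ≡+ zero    = refl
  fromℕ≡+ (suc a) = cong (λ z → 1ℤ + z) (fromℕ≡+ a)

module PrimePowerSums (p′ : ℕ) (pr : Prime (suc p′)) where

  open import Data.Nat as ℕ using (ℕ; zero; suc; _≤_; _<_; z≤n; s≤s)
  open import Data.Nat.Primality using (Prime; prime[2])
  import Data.Nat.Properties as ℕ
  import Data.Nat.Divisibility as ℕ
  open import Data.Nat.DivMod using (_%_; _/_; m%n<n; m≡m%n+[m/n]*n)
  open import Data.Nat.Coprimality as Coprime using (prime⇒coprime)
  open import Data.Nat.Induction using (<-rec)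
  open import Data.Nat.Combinatorics using (_C_; nCn≡1)
  open import Data.Nat.Tactic.RingSolver as ℕ-Solver using ()
  open import Data.Integer as ℤ using (ℤ; +_; _+_; _*_; -_; _-_; 0ℤ; 1ℤ)
  import Data.Integer.Properties as ℤ
  open import Data.Integer.Divisibility.Signed
  open import Data.Integer.Tactic.RingSolver using (solve-∀)
  open import Relation.Nullary using (¬_; contradiction)
  open import Relation.Binary.PropositionalEquality
  open BinomialsAndPrimes using (prime⇒1<p; prime∣pCk; [1+n]Cn≡1+n; prime∤m⇒prime∤m^k; prime∤⇒coprime)
  open IntegerPowerSums

  private
    p : ℕ
    p = suc p′

    instance
      p-1≢0 : ℕ.NonZero p′
      p-1≢0 = ℕ.>-nonZero (ℕ.≤-pred (prime⇒1<p pr))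

  p∣a^p-a : ∀ a → (+ p) ∣ (+ a) ^ p - + a
  p∣a^p-a zero    = subst ((+ p) ∣_) (sym (cong (_- 0ℤ) (ℤ.*-zeroˡ (0ℤ ^ p′)))) (∣ᵤ⇒∣ (ℕ._∣0 p))
  p∣a^p-a (suc a) = subst ((+ p) ∣_) (sym expand) (∣m∣n⇒∣m+n (p∣a^p-a a) p∣middle)
    where
    x = + a
    f : ℕ → ℤ
    f i = fromℕ (p C i) * x ^ i
    middle = sum p′ (λ i → f (suc i))
    p∣middle : (+ p) ∣ middle
    p∣middle = ∣-sum p′ _ (λ i i<p′ → ∣m⇒∣m*n (x ^ suc i)
      (subst ((+ p) ∣_) (sym (fromℕ≡+ (p C suc i))) (∣ᵤ⇒∣ (prime∣pCk pr (s≤s z≤n) (s≤s i<p′)))))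
    [a+1]^p : (+ suc a) ^ p ≡ (f 0 + middle) + f p
    [a+1]^p = begin
      (+ suc a) ^ p         ≡⟨ cong (_^ p) (ℤ.+-comm 1ℤ x) ⟩
      (x + 1ℤ) ^ p          ≡⟨ binomial p x ⟩
      sum p f + f p         ≡⟨ cong (_+ f p) (sum-head p′ f) ⟩
      (f 0 + middle) + f p  ∎
      where open ≡-Reasoning
    expand : (+ suc a) ^ p - + suc a ≡ (x ^ p - x) + middle
    expand = trans (cong (_- + suc a) (trans [a+1]^p (cong (λ u → (1ℤ * 1ℤ + middle) + fromℕ u * x ^ p) (nCn≡1 p))))
                   (identity x (x ^ p) middle)
      where identity : ∀ x P M → (1ℤ * 1ℤ + M) + (+ 1) * P - (1ℤ + x) ≡ (P - x) + M
            identity = solve-∀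

  p∣a^[r+1+c[p-1]]-a^[r+1] : ∀ a r c → (+ p) ∣ (+ a) ^ (suc r ℕ.+ c ℕ.* p′) - (+ a) ^ suc r
  p∣a^[r+1+c[p-1]]-a^[r+1] a r zero = subst ((+ p) ∣_)
    (sym (trans (cong (λ e → (+ a) ^ e - (+ a) ^ suc r) (ℕ.+-identityʳ (suc r))) (ℤ.+-inverseʳ ((+ a) ^ suc r))))
    (∣ᵤ⇒∣ (ℕ._∣0 p))
  p∣a^[r+1+c[p-1]]-a^[r+1] a r (suc c) = subst (λ e → (+ p) ∣ (+ a) ^ e - (+ a) ^ suc r) (sym exponent)
    (∣-diff-trans {x = x ^ (suc e ℕ.+ p′)} {y = x ^ suc e} (fermat-step e) (p∣a^[r+1+c[p-1]]-a^[r+1] a r c))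
    where
    x = + a
    e = r ℕ.+ c ℕ.* p′
    exponent : suc r ℕ.+ suc c ℕ.* p′ ≡ suc e ℕ.+ p′
    exponent = cong suc (identity r c p′)
      where identity : ∀ r c p → r ℕ.+ (p ℕ.+ c ℕ.* p) ≡ r ℕ.+ c ℕ.* p ℕ.+ p
            identity = ℕ-Solver.solve-∀
    fermat-step : ∀ e → (+ p) ∣ x ^ (suc e ℕ.+ p′) - x ^ suc e
    fermat-step e = subst ((+ p) ∣_) (sym factor) (∣n⇒∣m*n (x ^ e) (p∣a^p-a a))
      where
      factor : x ^ (suc e ℕ.+ p′) - x ^ suc e ≡ x ^ e * (x ^ p - x)
      factor = trans (cong (_- x ^ suc e) (trans (cong (x ^_) (sym (ℕ.+-suc e p′))) (^-homo-* x e p)))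
                     (identity (x ^ e) (x ^ p) x)
        where identity : ∀ q P x → q * P - x * q ≡ q * (P - x)
              identity = solve-∀

  -- Strong induction through powerSum-recurrence: the lower terms are divisible by p, and the top
  -- term has coefficient r + 1, which is prime to p.
  p∣powerSum-small : ∀ r → 1 ≤ r → suc r < p → (+ p) ∣ powerSumℤ p r
  p∣powerSum-small = <-rec (λ r → 1 ≤ r → suc r < p → (+ p) ∣ powerSumℤ p r) step
    where
    step : ∀ r → (∀ {i} → i < r → 1 ≤ i → suc i < p → (+ p) ∣ powerSumℤ p i) →
           1 ≤ r → suc r < p → (+ p) ∣ powerSumℤ p r
    step r IH 1≤r r+1<p = coprime-divisorℤ (powerSumℤ p r) (prime⇒coprime pr r+1<p) p∣[r+1]A
      where
      c : ℕ → ℤ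
      c i = fromℕ (suc r C i)
      lower = sum r (λ i → c i * powerSumℤ p i)
      p∣lower : (+ p) ∣ lower
      p∣lower = ∣-sum r _ λ
        { zero    _     → ∣n⇒∣m*n (c 0) (subst ((+ p) ∣_) (sym (powerSumℤ-0 p)) ∣-refl)
        ; (suc i) i+1<r → ∣n⇒∣m*n (c (suc i)) (IH i+1<r (s≤s z≤n) (ℕ.<-trans (s≤s i+1<r) r+1<p)) }
      p∣all : (+ p) ∣ lower + c r * powerSumℤ p r
      p∣all = subst ((+ p) ∣_) (sym (powerSum-recurrence r p)) (∣m⇒∣m*n ((+ p) ^ r) ∣-refl)
      p∣[r+1]A : (+ p) ∣ (+ suc r) * powerSumℤ p r
      p∣[r+1]A = subst (λ z → (+ p) ∣ z * powerSumℤ p r)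
                       (trans (cong fromℕ ([1+n]Cn≡1+n r)) (fromℕ≡+ (suc r))) (∣m+n∣m⇒∣n p∣all p∣lower)

  -- Fermat's little theorem reduces m to its residue modulo p − 1, which is nonzero.
  p∣powerSum : ∀ m → ¬ (p′ ℕ.∣ m) → (+ p) ∣ powerSumℤ p m
  p∣powerSum m p′∤m with m % p′ in m%p′≡r
  ... | zero  = contradiction (ℕ.m%n≡0⇒n∣m m p′ m%p′≡r) p′∤m
  ... | suc r = subst ((+ p) ∣_) (identity (powerSumℤ p m) (powerSumℤ p (suc r))) (∣m∣n⇒∣m+n reduce small)
    where
    identity : ∀ x y → (x - y) + y ≡ x
    identity = solve-∀
    m≡ : suc r ℕ.+ (m / p′) ℕ.* p′ ≡ m
    m≡ = trans (cong (ℕ._+ (m / p′) ℕ.* p′) (sym m%p′≡r)) (sym (m≡m%n+[m/n]*n m p′))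
    reduce : (+ p) ∣ powerSumℤ p m - powerSumℤ p (suc r)
    reduce = subst (λ e → (+ p) ∣ powerSumℤ p e - powerSumℤ p (suc r)) m≡
                   (∣-sum-diff p _ _ (λ j _ → p∣a^[r+1+c[p-1]]-a^[r+1] j r (m / p′)))
    small : (+ p) ∣ powerSumℤ p (suc r)
    small = p∣powerSum-small (suc r) (s≤s z≤n) (s≤s (subst (_< p′) m%p′≡r (m%n<n m p′)))

  -- The first-order part of (tq + i)^(m+1), summed over the blocks j = tq + i < pq.
  linearised : ℕ → ℕ → ℤ
  linearised m q = sum p (λ t → sum q (λ i → (+ i) ^ suc m + (+ suc m) * (+ (t ℕ.* q)) * (+ i) ^ m))

  -- Modulo (tq)², which pq divides, (tq + i)^(m+1) ≡ i^(m+1) + (m+1) tq i^m.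
  pq∣powerSum-linearised : ∀ m q → p ℕ.∣ q → (+ (p ℕ.* q)) ∣ powerSumℤ (p ℕ.* q) (suc m) - linearised m q
  pq∣powerSum-linearised m q p∣q =
    subst (λ s → d ∣ s - linearised m q) (sym (sum-blocks p q (λ j → (+ j) ^ suc m)))
          (∣-sum-diff p _ _ (λ t _ → ∣-sum-diff q _ _ (λ i _ → d∣term t i)))
    where
    d = + (p ℕ.* q)
    d∣q² : d ∣ (+ q) * (+ q)
    d∣q² = subst (_∣ (+ q) * (+ q)) (sym (ℤ.pos-* p q)) (*-monoˡ-∣ (+ q) (∣ᵤ⇒∣ {+ p} {+ q} p∣q))
    d∣term : ∀ t i → d ∣ (+ (t ℕ.* q ℕ.+ i)) ^ suc m - ((+ i) ^ suc m + (+ suc m) * (+ (t ℕ.* q)) * (+ i) ^ m)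
    d∣term t i = subst (d ∣_) (sym rearrange) (∣-trans d∣y² (y²∣[x+y]^[m+1]-x^[m+1]-[m+1]yx^m (+ i) y m))
      where
      y = + (t ℕ.* q)
      rearrange : (+ (t ℕ.* q ℕ.+ i)) ^ suc m - ((+ i) ^ suc m + (+ suc m) * y * (+ i) ^ m) ≡
                  (+ i + y) ^ suc m - (+ i) ^ suc m - (+ suc m) * y * (+ i) ^ m
      rearrange = trans (cong (λ z → z ^ suc m - ((+ i) ^ suc m + (+ suc m) * y * (+ i) ^ m))
                              (trans (ℤ.pos-+ (t ℕ.* q) i) (ℤ.+-comm y (+ i))))
                        (identity ((+ i + y) ^ suc m) ((+ i) ^ suc m) ((+ suc m) * y * (+ i) ^ m))
        where identity : ∀ a b c → a - (b + c) ≡ a - b - c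
              identity = solve-∀
      d∣y² : d ∣ y * y
      d∣y² = subst (d ∣_) (sym (trans (cong (λ z → z * z) (ℤ.pos-* t q)) (square (+ t) (+ q))))
                   (∣n⇒∣m*n ((+ t) * (+ t)) d∣q²)
        where square : ∀ a b → (a * b) * (a * b) ≡ (a * a) * (b * b)
              square = solve-∀

  linearised≡ : ∀ m q → linearised m q ≡
                (+ p) * powerSumℤ q (suc m) + (+ suc m) * (+ q) * powerSumℤ q m * sum p (λ t → + t)
  linearised≡ m q = begin
    linearised m q
      ≡⟨ sum-cong p (λ t → sum-+ q _ (λ i → (+ suc m) * (+ (t ℕ.* q)) * (+ i) ^ m)) ⟩
    sum p (λ t → powerSumℤ q (suc m) + sum q (λ i → (+ suc m) * (+ (t ℕ.* q)) * (+ i) ^ m))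
      ≡⟨ sum-cong p (λ t → cong (λ z → powerSumℤ q (suc m) + z) (linear-part t)) ⟩
    sum p (λ t → powerSumℤ q (suc m) + K * (+ t))
      ≡⟨ sum-+ p _ _ ⟩
    sum p (λ _ → powerSumℤ q (suc m)) + sum p (λ t → K * (+ t))
      ≡⟨ cong₂ _+_ (sum-const p _) (sym (*-distribˡ-sum p K _)) ⟩
    (+ p) * powerSumℤ q (suc m) + K * sum p (λ t → + t) ∎
    where
    open ≡-Reasoning
    K = (+ suc m) * (+ q) * powerSumℤ q m
    linear-part : ∀ t → sum q (λ i → (+ suc m) * (+ (t ℕ.* q)) * (+ i) ^ m) ≡ K * (+ t)
    linear-part t = trans (sym (*-distribˡ-sum q ((+ suc m) * (+ (t ℕ.* q))) (λ i → (+ i) ^ m)))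
      (trans (cong (λ z → (+ suc m) * z * powerSumℤ q m) (ℤ.pos-* t q)) (regroup (+ suc m) (+ t) (+ q) (powerSumℤ q m)))
      where regroup : ∀ a b c e → a * (b * c) * e ≡ a * c * e * b
            regroup = solve-∀

  pq∣2*linearised : ∀ m q → (+ q) ∣ powerSumℤ q (suc m) → (+ (p ℕ.* q)) ∣ (+ 2) * linearised m q
  pq∣2*linearised m q q∣A = subst (_ ∣_) (sym 2*linearised≡) (subst (_∣ expanded) (sym (ℤ.pos-* p q))
    (∣m∣n⇒∣m+n (∣n⇒∣m*n (+ 2) (*-monoʳ-∣ (+ p) q∣A)) (∣m⇒∣m*n ((+ suc m) * A′ * ((+ p) - 1ℤ)) ∣-refl)))
    where
    A = powerSumℤ q (suc m)
    A′ = powerSumℤ q m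
    expanded = (+ 2) * ((+ p) * A) + (+ p) * (+ q) * ((+ suc m) * A′ * ((+ p) - 1ℤ))
    2*linearised≡ : (+ 2) * linearised m q ≡ expanded
    2*linearised≡ = begin
      (+ 2) * linearised m q
        ≡⟨ cong ((+ 2) *_) (linearised≡ m q) ⟩
      (+ 2) * ((+ p) * A + (+ suc m) * (+ q) * A′ * sum p (λ t → + t))
        ≡⟨ distribute (+ p) A ((+ suc m) * (+ q) * A′) (sum p (λ t → + t)) ⟩
      (+ 2) * ((+ p) * A) + (+ suc m) * (+ q) * A′ * ((+ 2) * sum p (λ t → + t))
        ≡⟨ cong (λ z → (+ 2) * ((+ p) * A) + (+ suc m) * (+ q) * A′ * z) (2*Σt≡P*[P-1] p) ⟩
      (+ 2) * ((+ p) * A) + (+ suc m) * (+ q) * A′ * ((+ p) * ((+ p) - 1ℤ))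
        ≡⟨ cong (λ z → (+ 2) * ((+ p) * A) + z) (regroup (+ suc m) (+ q) A′ (+ p)) ⟩
      (+ 2) * ((+ p) * A) + (+ p) * (+ q) * ((+ suc m) * A′ * ((+ p) - 1ℤ)) ∎
      where
      open ≡-Reasoning
      distribute : ∀ P A K S → (+ 2) * (P * A + K * S) ≡ (+ 2) * (P * A) + K * ((+ 2) * S)
      distribute = solve-∀
      regroup : ∀ m q A P → m * q * A * (P * (P - 1ℤ)) ≡ (P * q) * (m * A * (P - 1ℤ))
      regroup = solve-∀

  pq∣2*powerSum : ∀ m q → p ℕ.∣ q → (+ q) ∣ powerSumℤ q (suc m) →
                  (+ (p ℕ.* q)) ∣ (+ 2) * powerSumℤ (p ℕ.* q) (suc m)
  pq∣2*powerSum m q p∣q q∣A = subst (_ ∣_) (double-split (powerSumℤ (p ℕ.* q) (suc m)) (linearised m q))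
    (∣m∣n⇒∣m+n (∣n⇒∣m*n (+ 2) (pq∣powerSum-linearised m q p∣q)) (pq∣2*linearised m q q∣A))
    where double-split : ∀ a b → (+ 2) * (a - b) + (+ 2) * b ≡ (+ 2) * a
          double-split = solve-∀

  p^[α+1]∣powerSum : ∀ m α → ¬ (p′ ℕ.∣ suc m) → ¬ (2 ℕ.∣ p) →
                     (+ (p ℕ.^ suc α)) ∣ powerSumℤ (p ℕ.^ suc α) (suc m)
  p^[α+1]∣powerSum m zero    p′∤m+1 _  =
    subst (λ q → (+ q) ∣ powerSumℤ q (suc m)) (sym (ℕ.*-identityʳ p)) (p∣powerSum (suc m) p′∤m+1)
  p^[α+1]∣powerSum m (suc α) p′∤m+1 2∤p =
    coprime-divisorℤ _ (Coprime.sym (prime∤⇒coprime prime[2] 2∤p^[α+2]))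
    (pq∣2*powerSum m (p ℕ.^ suc α) (ℕ.m∣m*n (p ℕ.^ α)) (p^[α+1]∣powerSum m α p′∤m+1 2∤p))
    where
    2∤p^[α+2] : ¬ (2 ℕ.∣ p ℕ.^ suc (suc α))
    2∤p^[α+2] = prime∤m⇒prime∤m^k (suc (suc α)) prime[2] 2∤p

module PowerSumDivisibility where

  open NaturalPowerSums using (powerSumℕ)
  open import Data.Nat as ℕ using (ℕ; zero; suc; _∸_; _≤_)
  import Data.Nat.Properties as ℕ
  import Data.Nat.Divisibility as ℕ
  open import Data.Nat.Primality using (Prime; prime[2])
  import Data.Nat.Coprimality as Coprime
  open import Data.Integer as ℤ using (ℤ; +_; _+_; _*_; _-_)
  import Data.Integer.Properties as ℤ
  open import Data.Integer.Divisibility.Signed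
  open import Data.Integer.Tactic.RingSolver using (solve-∀)
  open import Data.Product using (Σ; _×_; _,_)
  open import Data.Sum using (_⊎_; inj₁; inj₂)
  open import Relation.Nullary using (¬_; contradiction)
  open import Relation.Binary.PropositionalEquality
  open BinomialsAndPrimes using (prime⇒1<p; prime∤m⇒prime∤m^k; prime∤⇒coprime)
  open IntegerPowerSums

  Admissible : ℕ → ℕ → Set
  Admissible n k = n ℕ.∣ k ⊎ Σ ℕ (λ p → Σ ℕ (λ α →
                     Prime p × 1 ≤ α × n ≡ p ℕ.^ α × ¬ ((p ∸ 1) ℕ.∣ (k ∸ 1))))

  n∣k*U : ∀ n t → let k = suc (suc t ℕ.+ suc t) in
          ¬ (2 ℕ.∣ n) → Admissible n k → (+ n) ∣ (+ k) * powerSumℤ (suc n) (suc t ℕ.+ suc t)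
  n∣k*U n t _   (inj₁ n∣k) = ∣m⇒∣m*n (powerSumℤ (suc n) (suc t ℕ.+ suc t)) (∣ᵤ⇒∣ {+ n} {+ _} n∣k)
  n∣k*U n t 2∤n (inj₂ (suc p′ , suc α , pr , _ , n≡p^α , p′∤k-1)) =
    ∣n⇒∣m*n (+ suc (suc t ℕ.+ suc t)) (∣m∣n⇒∣m+n n∣powerSum (∣m⇒∣m*n ((+ n) ^ (t ℕ.+ suc t)) ∣-refl))
    where
    2∤p : ¬ (2 ℕ.∣ suc p′)
    2∤p 2∣p = 2∤n (ℕ.∣-trans 2∣p (subst (suc p′ ℕ.∣_) (sym n≡p^α) (ℕ.m∣m*n _)))
    n∣powerSum : (+ n) ∣ powerSumℤ n (suc t ℕ.+ suc t)
    n∣powerSum = subst (λ q → (+ q) ∣ powerSumℤ q (suc t ℕ.+ suc t)) (sym n≡p^α)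
                       (PrimePowerSums.p^[α+1]∣powerSum p′ pr (t ℕ.+ suc t) α p′∤k-1 2∤p)
  n∣k*U n t _ (inj₂ (zero , _ , pr , _)) = contradiction (prime⇒1<p pr) λ ()

  n²∣powerSum : ∀ n t → let k = suc (suc t ℕ.+ suc t) in
                ¬ (2 ℕ.∣ n) → Admissible n k → n ℕ.* n ℕ.∣ powerSumℕ (suc n) k
  n²∣powerSum n t 2∤n hyp = ∣⇒∣ᵤ (subst (+ (n ℕ.* n) ∣_) (sym +powerSumℕ≡) n²∣T)
    where
    k = suc (suc t ℕ.+ suc t)
    T = powerSumℤ (suc n) k
    U = powerSumℤ (suc n) (suc t ℕ.+ suc t)
    +powerSumℕ≡ : + powerSumℕ (suc n) k ≡ T
    +powerSumℕ≡ = trans (sym (fromℕ≡+ _))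
      (trans (fromℕ-powerSumℕ (suc n) k) (sum-cong (suc n) (λ j → cong (_^ k) (fromℕ≡+ j))))
    n²∣knU : (+ n) * (+ n) ∣ (+ k) * (+ n) * U
    n²∣knU = subst ((+ n) * (+ n) ∣_) (regroup (+ k) (+ n) U) (*-monoʳ-∣ (+ n) (n∣k*U n t 2∤n hyp))
      where regroup : ∀ k n U → n * (k * U) ≡ k * n * U
            regroup = solve-∀
    n²∣2T : (+ n) * (+ n) ∣ (+ 2) * T
    n²∣2T = subst ((+ n) * (+ n) ∣_) (sub-add ((+ 2) * T) ((+ k) * (+ n) * U))
                  (∣m∣n⇒∣m+n (n²∣2T-knU n (suc t)) n²∣knU)
      where sub-add : ∀ a b → (a - b) + b ≡ a
            sub-add = solve-∀
    n²∣T : + (n ℕ.* n) ∣ T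
    n²∣T = coprime-divisorℤ T (Coprime.sym (prime∤⇒coprime prime[2] 2∤n²))
             (subst (_∣ (+ 2) * T) (sym (ℤ.pos-* n n)) n²∣2T)
      where
      2∤n² : ¬ (2 ℕ.∣ n ℕ.* n)
      2∤n² = subst (λ m → ¬ (2 ℕ.∣ m)) (cong (n ℕ.*_) (ℕ.*-identityʳ n)) (prime∤m⇒prime∤m^k 2 prime[2] 2∤n)

open import Defs
open NaturalPowerSums using (powerSumℕ)
open Faulhaber using (signQ-odd)
open SumsAsPowerSums using (S⁺-value; S⁻-value)
open PowerSumDivisibility using (Admissible; n²∣powerSum)
open import Data.Nat
open import Data.Nat.Properties
open import Data.Nat.Divisibility using (_∣_; _∤_; divides; n∣m⇒m%n≡0)
open import Data.Nat.DivMod using (m≡m%n+[m/n]*n)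
open import Data.Nat.Primality using (Prime)
open import Data.Product using (Σ; _×_; _,_; proj₁; proj₂)
open import Data.Sum using (_⊎_)
open import Relation.Nullary using (¬_; contradiction)
open import Data.Nat.Tactic.RingSolver using (solve-∀)
open import Relation.Binary.PropositionalEquality

n%2≡1⇒2∤n : ∀ {n} → n % 2 ≡ 1 → 2 ∤ n
n%2≡1⇒2∤n {n} n%2≡1 2∣n = 0≢1+n (trans (sym (n∣m⇒m%n≡0 n 2 2∣n)) n%2≡1)

odd≥3⇒k≡3+2t : ∀ {k} → k % 2 ≡ 1 → 3 ≤ k → Σ ℕ (λ t → k ≡ suc (suc t + suc t))
odd≥3⇒k≡3+2t {k} k%2≡1 3≤k with k / 2 | m≡m%n+[m/n]*n k 2
... | zero  | k≡1+0 = contradiction (subst (3 ≤_) (trans k≡1+0 (cong (_+ 0) k%2≡1)) 3≤k) λ { (s≤s ()) }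
... | suc t | k≡r+[t+1]*2 = t , trans k≡r+[t+1]*2 (trans (cong (_+ suc t * 2) k%2≡1) (identity t))
  where identity : ∀ t → 1 + suc t * 2 ≡ suc (suc t + suc t)
        identity = solve-∀

powerSumℕ-positive : ∀ N k → 1 ≤ powerSumℕ (suc (suc N)) k
powerSumℕ-positive N k = ≤-trans (m^n>0 (suc N) k) (m≤n+m _ (powerSumℕ (suc N) k))

quotient-positive : ∀ {a b} c → 1 ≤ a → a ≡ c * b → 1 ≤ c
quotient-positive zero    1≤a a≡0 = contradiction (subst (1 ≤_) a≡0 1≤a) λ ()
quotient-positive (suc c) _   _   = s≤s z≤n

sums-in-ℕ : ∀ n t → suc n * suc n ∣ powerSumℕ (suc (suc n)) (suc (suc t + suc t)) →
            Inℕ (S⁺ (suc n) (suc (suc t + suc t))) × Inℕ (S⁻ (suc n) (suc (suc t + suc t)))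
sums-in-ℕ n t (divides c T≡c*n²) =
  (c , 1≤c , S⁺-value n _ c (s≤s z≤n) T≡n²*c) ,
  (c , 1≤c , S⁻-value n _ c (signQ-odd (suc t)) T≡n²*c)
  where
  T≡n²*c = trans T≡c*n² (*-comm c _)
  1≤c = quotient-positive c (powerSumℕ-positive n _) T≡c*n²

corollary4p1 : (n : ℕ) → .{{_ : NonZero n}} → n % 2 ≡ 1 →
    (k : ℕ) → k % 2 ≡ 1 → 3 ≤ k →
    (n ∣ k ⊎ Σ ℕ (λ p → Σ ℕ (λ α → Prime p × 1 ≤ α × n ≡ p ^ α × ¬ ((p ∸ 1) ∣ (k ∸ 1))))) →
    Inℕ (S⁺ n k) × Inℕ (S⁻ n k)
corollary4p1 (suc n) n%2≡1 k k%2≡1 3≤k hyp =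
  subst (λ k → Inℕ (S⁺ (suc n) k) × Inℕ (S⁻ (suc n) k)) (sym k≡3+2t)
        (sums-in-ℕ n t (n²∣powerSum (suc n) t (n%2≡1⇒2∤n n%2≡1) (subst (Admissible (suc n)) k≡3+2t hyp)))
  where
  t = proj₁ (odd≥3⇒k≡3+2t k%2≡1 3≤k)
  k≡3+2t = proj₂ (odd≥3⇒k≡3+2t k%2≡1 3≤k)
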